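{- Let $\Lambda=(\Lambda_1,\dots,\Lambda_m;\Lambda_{m+1},\dots,\Lambda_N)$ be a superpartition, let $\tilde\Lambda=(\Lambda_m,\dots,\Lambda_1,\Lambda_N,\dots,\Lambda_{m+1})$, and let $\ell(\Lambda^s)$ be the number of nonzero entries among $\Lambda_{m+1},\dots,\Lambda_N$. Then $$\frac{\Bigl(\prod_{s\in\tilde\Lambda}d_{\tilde\Lambda}(s)\Bigr)\Bigl(\prod_{i\ge1}m_i(\Lambda^s)!\Bigr)}{\prod_{s\in\Lambda^\circ}\bigl(\alpha\,a_\Lambda(s)+\ell_\Lambda(s)+1\bigr)}=\Bigl(\prod_{i=N-\ell(\Lambda^s)+1}^{N}d_{\tilde\Lambda}((i,1))\Bigr)\Bigl(\prod_{1\le j<i\le m}d_{\tilde\Lambda}((i,\tilde\Lambda_j+1))\Bigr).$$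
   Context: A superpartition is $\Lambda=(\Lambda_1,\dots,\Lambda_m;\Lambda_{m+1},\dots,\Lambda_N)$ with $\Lambda_1>\dots>\Lambda_m\ge0$ and $\Lambda_{m+1}\ge\dots\ge\Lambda_N\ge0$; $\Lambda^a=(\Lambda_1,\dots,\Lambda_m)$, $\Lambda^s=(\Lambda_{m+1},\dots,\Lambda_N)$, and $m_i(\Lambda^s)$ is the number of entries of $\Lambda^s$ equal to $i$. $\alpha$ is a formal parameter. For a composition $\eta\in\mathbb Z_{\ge0}^N$, its diagram is the set of cells $(i,j)$ with $1\le i\le N$, $1\le j\le\eta_i$. For a cell $s=(i,j)$: $\mathbf a_\eta(s)=\eta_i-j$, $\mathbf l'_\eta(s)=\#\{k<i: j\le\eta_k+1\le\eta_i\}$, $\mathbf l''_\eta(s)=\#\{k>i: j\le\eta_k\le\eta_i\}$, $d_\eta(s)=\alpha(\mathbf a_\eta(s)+1)+\mathbf l'_\eta(s)+\mathbf l''_\eta(s)+1$. Diagram $D[\Lambda]$: the Ferrers diagram (rows from top to bottom) of the partition obtained by sorting all entries of $\Lambda$ in non-increasing order, with a circle added at the end of each row corresponding to an entry of $\Lambda^a$ (in column $\Lambda_i+1$); when an entry of $\Lambda^a$ equals some entries of $\Lambda^s$, the circled row is the topmost among rows of that length. For a (non-circle) cell $s$ of $D[\Lambda]$, $a_\Lambda(s)$ is the number of cells to the right of $s$ in its row, counting the circle if present, and $\ell_\Lambda(s)$ is the number of cells below $s$ in its column, not counting a circle. $\Lambda^\circ$ is the set of cells of $D[\Lambda]$ that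 do not lie simultaneously in a row containing a circle and in a column containing a circle. -}

module Defs where

open import Data.Nat using (ℕ; zero; suc; _+_; _*_; _∸_; _⊔_; _>_; _≥_; _!; _≡ᵇ_; _≤ᵇ_; _<ᵇ_)
open import Data.Bool using (Bool; true; false; _∧_; _∨_; not; if_then_else_)
open import Data.List using (List; []; _∷_; map; _++_; length; reverse; upTo; concatMap; filterᵇ; foldr)
open import Data.Nat.ListAction using (sum; product)
open import Data.Bool.ListAction using (any)
open import Data.Product using (_×_; _,_; proj₁; proj₂)
open import Data.List.Relation.Unary.Linked using (Linked)

-- Generic helpers (all indices are 1-based, as in the paper)

-- 1-based lookup, 0 outside the range (only used inside the range).
at : List ℕ → ℕ → ℕ
at []       _             = 0
at (x ∷ xs) zero          = 0
at (x ∷ xs) (suc zero)    = x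
at (x ∷ xs) (suc (suc k)) = at xs (suc k)

interval : ℕ → ℕ → List ℕ
interval a b = map (a +_) (upTo (suc b ∸ a))

countᵇ : (ℕ → Bool) → List ℕ → ℕ
countᵇ p xs = sum (map (λ k → if p k then 1 else 0) xs)

-- Superpartitions: Λ = (Λa ; Λs), with m = length Λa, N = m + length Λs.

record IsSuperpartition (Λa Λs : List ℕ) : Set where
  field
    antisym-strict : Linked _>_ Λa
    sym-weak       : Linked _≥_ Λs

armC : List ℕ → ℕ → ℕ → ℕ
armC η i j = at η i ∸ j

leg′ : List ℕ → ℕ → ℕ → ℕ
leg′ η i j = countᵇ (λ k → (j ≤ᵇ at η k + 1) ∧ (at η k + 1 ≤ᵇ at η i)) (interval 1 (i ∸ 1))

leg″ : List ℕ → ℕ → ℕ → ℕ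
leg″ η i j = countᵇ (λ k → (j ≤ᵇ at η k) ∧ (at η k ≤ᵇ at η i)) (interval (suc i) (length η))

dC : ℕ → List ℕ → ℕ → ℕ → ℕ
dC α η i j = α * (armC η i j + 1) + leg′ η i j + leg″ η i j + 1

cellsC : List ℕ → List (ℕ × ℕ)
cellsC η = concatMap (λ i → map (i ,_) (interval 1 (at η i))) (interval 1 (length η))

-- The diagram D[Λ]: rows (length, circled?) from top to bottom.
-- Sorted by length non-increasingly; among equal lengths the circled row is on top.

before : ℕ × Bool → ℕ × Bool → Bool
before (l , c) (l′ , c′) = (l′ <ᵇ l) ∨ ((l ≡ᵇ l′) ∧ c)

insertRow : ℕ × Bool → List (ℕ × Bool) → List (ℕ × Bool)
insertRow x []       = x ∷ []
insertRow x (y ∷ ys) = if before x y then x ∷ y ∷ ys else y ∷ insertRow x ys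

sortRows : List (ℕ × Bool) → List (ℕ × Bool)
sortRows = foldr insertRow []

rowsD : List ℕ → List ℕ → List (ℕ × Bool)
rowsD Λa Λs = sortRows (map (_, true) Λa ++ map (_, false) Λs)

atRow : List (ℕ × Bool) → ℕ → ℕ × Bool
atRow []       _             = (0 , false)
atRow (x ∷ xs) zero          = (0 , false)
atRow (x ∷ xs) (suc zero)    = x
atRow (x ∷ xs) (suc (suc k)) = atRow xs (suc k)

rowLen : List (ℕ × Bool) → ℕ → ℕ
rowLen R r = proj₁ (atRow R r)

rowCirc : List (ℕ × Bool) → ℕ → Bool
rowCirc R r = proj₂ (atRow R r)

-- non-circle cells (r,j) of D[Λ]
cellsD : List ℕ → List ℕ → List (ℕ × ℕ)
cellsD Λa Λs = concatMap (λ r → map (r ,_) (interval 1 (rowLen R r))) (interval 1 (length R))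
  where R = rowsD Λa Λs

-- a_Λ(s): cells to the right in the row, counting the circle if present
armD : List ℕ → List ℕ → ℕ → ℕ → ℕ
armD Λa Λs r j = rowLen R r ∸ j + (if rowCirc R r then 1 else 0)
  where R = rowsD Λa Λs

-- ℓ_Λ(s): cells below in the column, not counting circles
legD : List ℕ → List ℕ → ℕ → ℕ → ℕ
legD Λa Λs r j = countᵇ (λ r′ → j ≤ᵇ rowLen R r′) (interval (suc r) (length R))
  where R = rowsD Λa Λs

colCirc : List ℕ → List ℕ → ℕ → Bool
colCirc Λa Λs j = any (λ r′ → rowCirc R r′ ∧ (rowLen R r′ + 1 ≡ᵇ j)) (interval 1 (length R))
  where R = rowsD Λa Λs

cellsCirc : List ℕ → List ℕ → List (ℕ × ℕ)
cellsCirc Λa Λs = filterᵇ (λ s → not (rowCirc (rowsD Λa Λs) (proj₁ s) ∧ colCirc Λa Λs (proj₂ s))) (cellsD Λa Λs)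

tilde : List ℕ → List ℕ → List ℕ
tilde Λa Λs = reverse Λa ++ reverse Λs

mult : ℕ → List ℕ → ℕ
mult i Λs = countᵇ (λ x → x ≡ᵇ i) Λs

maxL : List ℕ → ℕ
maxL = foldr _⊔_ 0

-- ∏_{i ≥ 1} m_i(Λs)!   (factors with i > max Λs are 0! = 1)
multFact : List ℕ → ℕ
multFact Λs = product (map (λ i → mult i Λs !) (interval 1 (maxL Λs)))

ellS : List ℕ → ℕ
ellS Λs = countᵇ (λ x → not (x ≡ᵇ 0)) Λs

lhsNum : ℕ → List ℕ → List ℕ → ℕ
lhsNum α Λa Λs = product (map (λ s → dC α η (proj₁ s) (proj₂ s)) (cellsC η))
  where η = tilde Λa Λs

lhsDen : ℕ → List ℕ → List ℕ → ℕ
lhsDen α Λa Λs = product (map (λ s → α * armD Λa Λs (proj₁ s) (proj₂ s) + legD Λa Λs (proj₁ s) (proj₂ s) + 1) (cellsCirc Λa Λs))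

rhs : ℕ → List ℕ → List ℕ → ℕ
rhs α Λa Λs =
  product (map (λ i → dC α η i 1) (interval (suc (N ∸ ellS Λs)) N))
  * product (concatMap (λ i → map (λ j → dC α η i (at η j + 1)) (interval 1 (i ∸ 1))) (interval 1 m))
  where
    η = tilde Λa Λs
    m = length Λa
    N = length Λa + length Λs

-- Both sides are products over rows. In Λ̃ an antisymmetric row a is preceded only by the smaller entries of Λa and
-- followed by the larger ones and by all of Λs, and a symmetric row s is preceded by Λa and the smaller entries of Λs
-- and followed by the entries of Λs that are at least s. Hence d on a row of Λ̃ depends only on its length, on Λa and
-- Λs, and for a symmetric row on the number t of equal entries following it; the same holds for the hooks of D[Λ],
-- whose rows are Λa and Λs merged by length. On an antisymmetric row a, d agrees with the hook in every column without
-- a circle, and the circled columns are the columns b + 1 with b < a in Λa: their cells give the second product of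
-- the right-hand side. On a symmetric row s > 0, d in column j + 1 is the hook in column j, so what remains is d in
-- the first cell, giving the first product of the right-hand side, and the last hook t + 1; over the entries of Λs
-- equal to s these last hooks multiply to m_s(Λs)!.

module Submission where

open import Defs
open import Data.Nat using (ℕ; zero; suc; _+_; _*_; _∸_; _!; _<_; _≤_; _≥_; _>_; _≡ᵇ_; _≤ᵇ_; _<ᵇ_; s≤s; z≤n)
open import Data.Nat.Properties
open import Data.Bool using (Bool; T; true; false; _∧_; _∨_; not; if_then_else_)
open import Data.Bool.Properties using (∧-identityʳ; ∧-zeroʳ; ∨-assoc)
open import Data.List using (List; []; _∷_; [_]; _++_; map; length; reverse; upTo; applyUpTo; concatMap; filterᵇ; foldr; take; drop)
open import Data.List.Properties
open import Data.Nat.ListAction using (product)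
open import Data.Nat.ListAction.Properties using (product-++; product-↭)
open import Data.Bool.ListAction using (any; or)
open import Data.List.Relation.Unary.All as All using (All; []; _∷_) renaming (map to All-map)
open import Data.List.Relation.Unary.All.Properties using (++⁺; applyUpTo⁺₁)
open import Data.List.Relation.Unary.AllPairs using (AllPairs; []; _∷_)
open import Data.List.Relation.Unary.Linked.Properties using (Linked⇒AllPairs)
open import Data.List.Relation.Binary.Permutation.Propositional using (↭-sym)
open import Data.List.Relation.Binary.Permutation.Propositional.Properties using (↭-reverse; All-resp-↭)
open import Data.Product using (Σ; _×_; _,_; proj₁; proj₂)
open import Data.Sum using (_⊎_; inj₁; inj₂)
open import Function using (_∘_)
open import Relation.Nullary using (¬_; yes; no; contradiction)
open import Relation.Nullary.Decidable using (T?)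
open import Relation.Nullary.Reflects using (Reflects; ofʸ; ofⁿ; fromEquivalence)
open import Relation.Binary.PropositionalEquality hiding ([_])
import Algebra.Properties.CommutativeSemigroup as CommSemigroupProperties
open CommSemigroupProperties +-commutativeSemigroup using () renaming (interchange to +-interchange; x∙yz≈y∙xz to +-x∙yz≈y∙xz)
open CommSemigroupProperties *-commutativeSemigroup using () renaming (interchange to *-interchange; x∙yz≈y∙xz to *-x∙yz≈y∙xz; xy∙z≈xz∙y to *-xy∙z≈xz∙y; xy∙z≈x∙zy to *-xy∙z≈x∙zy)

reflects-true : ∀ {P : Set} {b} → Reflects P b → P → b ≡ true
reflects-true (ofʸ _)  _ = refl
reflects-true (ofⁿ ¬p) p = contradiction p ¬p

reflects-false : ∀ {P : Set} {b} → Reflects P b → ¬ P → b ≡ false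
reflects-false (ofʸ p) ¬p = contradiction p ¬p
reflects-false (ofⁿ _) _  = refl

reflects-sound : ∀ {P : Set} {b} → Reflects P b → b ≡ true → P
reflects-sound (ofʸ p) _ = p

≡ᵇ-reflects-≡ : ∀ m n → Reflects (m ≡ n) (m ≡ᵇ n)
≡ᵇ-reflects-≡ m n = fromEquivalence (≡ᵇ⇒≡ m n) (≡⇒≡ᵇ m n)

≤⇒≤ᵇ≡true : ∀ {m n} → m ≤ n → (m ≤ᵇ n) ≡ true
≤⇒≤ᵇ≡true {m} {n} = reflects-true (≤ᵇ-reflects-≤ m n)

>⇒≤ᵇ≡false : ∀ {m n} → n < m → (m ≤ᵇ n) ≡ false
>⇒≤ᵇ≡false {m} {n} n<m = reflects-false (≤ᵇ-reflects-≤ m n) (<⇒≱ n<m)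

<⇒<ᵇ≡true : ∀ {m n} → m < n → (m <ᵇ n) ≡ true
<⇒<ᵇ≡true {m} {n} = reflects-true (<ᵇ-reflects-< m n)

≥⇒<ᵇ≡false : ∀ {m n} → n ≤ m → (m <ᵇ n) ≡ false
≥⇒<ᵇ≡false {m} {n} n≤m = reflects-false (<ᵇ-reflects-< m n) (≤⇒≯ n≤m)

≡ᵇ-refl : ∀ m → (m ≡ᵇ m) ≡ true
≡ᵇ-refl m = reflects-true (≡ᵇ-reflects-≡ m m) refl

≢⇒≡ᵇ≡false : ∀ {m n} → m ≢ n → (m ≡ᵇ n) ≡ false
≢⇒≡ᵇ≡false {m} {n} = reflects-false (≡ᵇ-reflects-≡ m n)

≡ᵇ≡false⇒≢ : ∀ {m n} → (m ≡ᵇ n) ≡ false → m ≢ n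
≡ᵇ≡false⇒≢ {m} e refl = contradiction (trans (sym (≡ᵇ-refl m)) e) λ ()

≤ᵇ≡true⇒≤ : ∀ {m n} → (m ≤ᵇ n) ≡ true → m ≤ n
≤ᵇ≡true⇒≤ {m} {n} = reflects-sound (≤ᵇ-reflects-≤ m n)

if-intro : ∀ {A : Set} {P : A → Set} b {x y} → (b ≡ true → P x) → (b ≡ false → P y) → P (if b then x else y)
if-intro true  px _  = px refl
if-intro false _  py = py refl

indicator : Bool → ℕ
indicator b = if b then 1 else 0

countᵇ-++ : ∀ p xs ys → countᵇ p (xs ++ ys) ≡ countᵇ p xs + countᵇ p ys
countᵇ-++ p []       ys = refl
countᵇ-++ p (x ∷ xs) ys = trans (cong (indicator (p x) +_) (countᵇ-++ p xs ys)) (sym (+-assoc (indicator (p x)) _ _))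

countᵇ-reverse : ∀ p xs → countᵇ p (reverse xs) ≡ countᵇ p xs
countᵇ-reverse p []       = refl
countᵇ-reverse p (x ∷ xs) = begin
  countᵇ p (reverse (x ∷ xs))          ≡⟨ cong (countᵇ p) (unfold-reverse x xs) ⟩
  countᵇ p (reverse xs ++ [ x ])       ≡⟨ countᵇ-++ p (reverse xs) [ x ] ⟩
  countᵇ p (reverse xs) + countᵇ p [ x ] ≡⟨ cong₂ _+_ (countᵇ-reverse p xs) (+-identityʳ (indicator (p x))) ⟩
  countᵇ p xs + indicator (p x)        ≡⟨ +-comm (countᵇ p xs) _ ⟩
  countᵇ p (x ∷ xs)                    ∎
  where open ≡-Reasoning

countᵇ-none : ∀ p xs → All (λ y → p y ≡ false) xs → countᵇ p xs ≡ 0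
countᵇ-none p []       []       = refl
countᵇ-none p (x ∷ xs) (e ∷ es) rewrite e = countᵇ-none p xs es

countᵇ-every : ∀ p xs → All (λ y → p y ≡ true) xs → countᵇ p xs ≡ length xs
countᵇ-every p []       []       = refl
countᵇ-every p (x ∷ xs) (e ∷ es) rewrite e = cong suc (countᵇ-every p xs es)

countᵇ-cong : ∀ p q xs → All (λ y → p y ≡ q y) xs → countᵇ p xs ≡ countᵇ q xs
countᵇ-cong p q []       []       = refl
countᵇ-cong p q (x ∷ xs) (e ∷ es) = cong₂ (λ b n → indicator b + n) e (countᵇ-cong p q xs es)

countᵇ-map : ∀ p (f : ℕ → ℕ) xs → countᵇ p (map f xs) ≡ countᵇ (p ∘ f) xs
countᵇ-map p f []       = refl
countᵇ-map p f (x ∷ xs) = cong (indicator (p (f x)) +_) (countᵇ-map p f xs)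

countᵇ-split : ∀ p q r xs → All (λ y → indicator (p y) ≡ indicator (q y) + indicator (r y)) xs →
  countᵇ p xs ≡ countᵇ q xs + countᵇ r xs
countᵇ-split p q r []       []       = refl
countᵇ-split p q r (x ∷ xs) (e ∷ es) = trans (cong₂ _+_ e (countᵇ-split p q r xs es))
  (+-interchange (indicator (q x)) (indicator (r x)) (countᵇ q xs) (countᵇ r xs))

any-none : ∀ {A : Set} (p : A → Bool) xs → All (λ x → p x ≡ false) xs → any p xs ≡ false
any-none p []       []       = refl
any-none p (x ∷ xs) (e ∷ es) rewrite e = any-none p xs es

any≡false⇒none : ∀ {A : Set} (p : A → Bool) xs → any p xs ≡ false → All (λ x → p x ≡ false) xs
any≡false⇒none p []       _ = []
any≡false⇒none p (x ∷ xs) e with p x in px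
... | false = px ∷ any≡false⇒none p xs e

any-++ : ∀ {A : Set} (p : A → Bool) xs ys → any p (xs ++ ys) ≡ any p xs ∨ any p ys
any-++ p []       ys = refl
any-++ p (x ∷ xs) ys = trans (cong (p x ∨_) (any-++ p xs ys)) (sym (∨-assoc (p x) (any p xs) (any p ys)))

All-reverse : ∀ {A : Set} {P : A → Set} {xs} → All P xs → All P (reverse xs)
All-reverse {xs = xs} = All-resp-↭ (↭-sym (↭-reverse xs))

AllPairs-++⁻ : ∀ {A : Set} {R : A → A → Set} B xs → AllPairs R (B ++ xs) → All (λ b → All (R b) xs) B × AllPairs R xs
AllPairs-++⁻ []      xs Rxs       = [] , Rxs
AllPairs-++⁻ (b ∷ B) xs (Rb ∷ RBxs) with AllPairs-++⁻ B xs RBxs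
... | RBxs′ , Rxs = drop-prefix B Rb ∷ RBxs′ , Rxs
  where
  drop-prefix : ∀ B → All _ (B ++ xs) → All _ xs
  drop-prefix []      Rbxs       = Rbxs
  drop-prefix (_ ∷ B) (_ ∷ Rbxs) = drop-prefix B Rbxs

product-map-reverse : ∀ {A : Set} (f : A → ℕ) xs → product (map f (reverse xs)) ≡ product (map f xs)
product-map-reverse f xs = trans (cong product (reverse-map f xs)) (product-↭ (↭-reverse (map f xs)))

product-concatMap : ∀ {A : Set} (f : A → List ℕ) xs →
  product (concatMap f xs) ≡ product (map (product ∘ f) xs)
product-concatMap f []       = refl
product-concatMap f (x ∷ xs) = trans (product-++ (f x) (concatMap f xs)) (cong (product (f x) *_) (product-concatMap f xs))

product-map-concatMap : ∀ {A B : Set} (h : B → ℕ) (f : A → List B) xs →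
  product (map h (concatMap f xs)) ≡ product (map (λ x → product (map h (f x))) xs)
product-map-concatMap h f []       = refl
product-map-concatMap h f (x ∷ xs) = begin
  product (map h (f x ++ concatMap f xs))                 ≡⟨ cong product (map-++ h (f x) (concatMap f xs)) ⟩
  product (map h (f x) ++ map h (concatMap f xs))         ≡⟨ product-++ (map h (f x)) _ ⟩
  product (map h (f x)) * product (map h (concatMap f xs)) ≡⟨ cong (product (map h (f x)) *_) (product-map-concatMap h f xs) ⟩
  product (map (λ x → product (map h (f x))) (x ∷ xs))     ∎
  where open ≡-Reasoning

product-map-∘ : ∀ {A B : Set} (h : B → ℕ) (f : A → B) xs → product (map h (map f xs)) ≡ product (map (h ∘ f) xs)
product-map-∘ h f xs = cong product (sym (map-∘ xs))

product-map-* : ∀ {A : Set} (f g : A → ℕ) xs →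
  product (map (λ x → f x * g x) xs) ≡ product (map f xs) * product (map g xs)
product-map-* f g []       = refl
product-map-* f g (x ∷ xs) = trans (cong (f x * g x *_) (product-map-* f g xs))
  (*-interchange (f x) (g x) (product (map f xs)) (product (map g xs)))

product-map-ones : ∀ {A : Set} (f : A → ℕ) xs → All (λ x → f x ≡ 1) xs → product (map f xs) ≡ 1
product-map-ones f []       []       = refl
product-map-ones f (x ∷ xs) (e ∷ es) rewrite e = trans (+-identityʳ _) (product-map-ones f xs es)

prodTails : {X : Set} → (X → List X → ℕ) → List X → ℕ
prodTails Γ []       = 1
prodTails Γ (x ∷ xs) = Γ x xs * prodTails Γ xs

prodTails-* : ∀ {X : Set} (f g : X → List X → ℕ) xs → prodTails (λ x xs → f x xs * g x xs) xs ≡ prodTails f xs * prodTails g xs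
prodTails-* f g []       = refl
prodTails-* f g (x ∷ xs) = trans (cong (f x xs * g x xs *_) (prodTails-* f g xs))
  (*-interchange (f x xs) (g x xs) (prodTails f xs) (prodTails g xs))

prodTails-cong : ∀ {X : Set} {f g : X → List X → ℕ} A → (∀ B x xs → B ++ x ∷ xs ≡ A → f x xs ≡ g x xs) →
  prodTails f A ≡ prodTails g A
prodTails-cong {f = f} {g} A e = go [] A refl
  where
  go : ∀ B xs → B ++ xs ≡ A → prodTails f xs ≡ prodTails g xs
  go B []       _  = refl
  go B (x ∷ xs) eq = cong₂ _*_ (e B x xs eq) (go (B ++ [ x ]) xs (trans (∷ʳ-++ B x xs) eq))

prodOccBefore : (ℕ → ℕ → ℕ) → List ℕ → List ℕ → ℕ
prodOccBefore g seen []       = 1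
prodOccBefore g seen (x ∷ xs) = g x (mult x seen) * prodOccBefore g (x ∷ seen) xs

prodOccAfter : (ℕ → ℕ → ℕ) → List ℕ → ℕ
prodOccAfter g []       = 1
prodOccAfter g (x ∷ xs) = g x (mult x xs) * prodOccAfter g xs

-- Counting equal entries before or after an entry gives the same multiset of pairs (entry, count).
prodOccBefore≡prodOccAfter : ∀ g seen xs → prodOccBefore g seen xs ≡ prodOccAfter (λ z k → g z (mult z seen + k)) xs
prodOccBefore≡prodOccAfter g seen []       = refl
prodOccBefore≡prodOccAfter g seen (x ∷ xs) =
  trans (cong (g x (mult x seen) *_) (prodOccBefore≡prodOccAfter g (x ∷ seen) xs)) (move-to-front seen xs)
  where
  move-to-front : ∀ seen xs →
    g x (mult x seen) * prodOccAfter (λ z k → g z (mult z (x ∷ seen) + k)) xs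
      ≡ g x (mult x seen + mult x xs) * prodOccAfter (λ z k → g z (mult z seen + k)) xs
  move-to-front seen []       = cong (λ k → g x k * 1) (sym (+-identityʳ (mult x seen)))
  move-to-front seen (y ∷ ys) with x ≟ y
  ... | yes refl rewrite ≡ᵇ-refl x = begin
    g x c * (g x (suc c + d) * P′)  ≡⟨ *-x∙yz≈y∙xz (g x c) (g x (suc c + d)) P′ ⟩
    g x (suc c + d) * (g x c * P′)  ≡⟨ cong (g x (suc c + d) *_) (move-to-front seen ys) ⟩
    g x (suc c + d) * (g x (c + d) * P) ≡⟨ cong (λ k → g x k * (g x (c + d) * P)) (sym (+-suc c d)) ⟩
    g x (c + suc d) * (g x (c + d) * P) ∎
    where
    open ≡-Reasoning
    c = mult x seen
    d = mult x ys
    P′ = prodOccAfter (λ z k → g z (mult z (x ∷ seen) + k)) ys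
    P = prodOccAfter (λ z k → g z (mult z seen + k)) ys
  ... | no x≢y rewrite ≢⇒≡ᵇ≡false x≢y | ≢⇒≡ᵇ≡false (x≢y ∘ sym) = begin
    g x c * (g y e * P′)        ≡⟨ *-x∙yz≈y∙xz (g x c) (g y e) P′ ⟩
    g y e * (g x c * P′)        ≡⟨ cong (g y e *_) (move-to-front seen ys) ⟩
    g y e * (g x (c + d) * P)   ≡⟨ *-x∙yz≈y∙xz (g y e) (g x (c + d)) P ⟩
    g x (c + d) * (g y e * P)   ∎
    where
    open ≡-Reasoning
    c = mult x seen
    d = mult x ys
    e = mult y seen + mult y ys
    P′ = prodOccAfter (λ z k → g z (mult z (x ∷ seen) + k)) ys
    P = prodOccAfter (λ z k → g z (mult z seen + k)) ys

prodOccAfter-* : ∀ f g xs → prodOccAfter (λ s t → f s t * g s t) xs ≡ prodOccAfter f xs * prodOccAfter g xs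
prodOccAfter-* f g []       = refl
prodOccAfter-* f g (x ∷ xs) = trans (cong (f x (mult x xs) * g x (mult x xs) *_) (prodOccAfter-* f g xs))
  (*-interchange (f x (mult x xs)) (g x (mult x xs)) (prodOccAfter f xs) (prodOccAfter g xs))

prodOccAfter-cong : ∀ {f g} xs → (∀ s t → f s t ≡ g s t) → prodOccAfter f xs ≡ prodOccAfter g xs
prodOccAfter-cong []       e = refl
prodOccAfter-cong (x ∷ xs) e = cong₂ _*_ (e x _) (prodOccAfter-cong xs e)

All-range : ∀ {P : ℕ → Set} a k → (∀ {i} → i < k → P (a + i)) → All P (map (a +_) (upTo k))
All-range a k h = subst (All _) (sym (map-applyUpTo (λ i → i) (a +_) k)) (applyUpTo⁺₁ (a +_) k h)

range-cong : ∀ {A : Set} {f g : ℕ → A} a k → (∀ {i} → i < k → f (a + i) ≡ g (a + i)) →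
  map f (map (a +_) (upTo k)) ≡ map g (map (a +_) (upTo k))
range-cong a k h = map-cong-local (All-range a k h)

upTo-cong : ∀ {A : Set} {f g : ℕ → A} k → (∀ {i} → i < k → f i ≡ g i) → map f (upTo k) ≡ map g (upTo k)
upTo-cong k h = map-cong-local (applyUpTo⁺₁ (λ i → i) k h)

range-suc : ∀ a k → map (a +_) (upTo (suc k)) ≡ a ∷ map (suc a +_) (upTo k)
range-suc a k = cong₂ _∷_ (+-identityʳ a) (begin
  map (a +_) (applyUpTo suc k)   ≡⟨ map-applyUpTo suc (a +_) k ⟩
  applyUpTo (λ i → a + suc i) k  ≡⟨ applyUpTo-cong k (+-suc a) ⟩
  applyUpTo (suc a +_) k         ≡⟨ sym (map-applyUpTo (λ i → i) (suc a +_) k) ⟩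
  map (suc a +_) (upTo k)        ∎)
  where
  open ≡-Reasoning
  applyUpTo-cong : ∀ {f g : ℕ → ℕ} n → (∀ i → f i ≡ g i) → applyUpTo f n ≡ applyUpTo g n
  applyUpTo-cong zero    e = refl
  applyUpTo-cong (suc n) e = cong₂ _∷_ (e 0) (applyUpTo-cong n (e ∘ suc))

range-snoc : ∀ a k → map (a +_) (upTo (suc k)) ≡ map (a +_) (upTo k) ++ [ a + k ]
range-snoc a k = trans (cong (map (a +_)) (sym (upTo-∷ʳ k))) (map-++ (a +_) (upTo k) [ k ])

prodTo : (ℕ → ℕ) → ℕ → ℕ
prodTo h n = product (map h (map (1 +_) (upTo n)))

prodTo-cong : ∀ {h h′} x → (∀ j → 1 ≤ j → j ≤ x → h j ≡ h′ j) → prodTo h x ≡ prodTo h′ x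
prodTo-cong x e = cong product (range-cong 1 x (λ {i} i<x → e (suc i) (s≤s z≤n) i<x))

prodTo-snoc : ∀ f n → prodTo f (suc n) ≡ prodTo f n * f (suc n)
prodTo-snoc f n = begin
  product (map f (map (1 +_) (upTo (suc n))))             ≡⟨ cong (product ∘ map f) (range-snoc 1 n) ⟩
  product (map f (map (1 +_) (upTo n) ++ [ suc n ]))      ≡⟨ cong product (map-++ f (map (1 +_) (upTo n)) [ suc n ]) ⟩
  product (map f (map (1 +_) (upTo n)) ++ [ f (suc n) ])  ≡⟨ product-++ (map f (map (1 +_) (upTo n))) [ f (suc n) ] ⟩
  prodTo f n * (f (suc n) * 1)                            ≡⟨ cong (prodTo f n *_) (*-identityʳ (f (suc n))) ⟩
  prodTo f n * f (suc n)                                  ∎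
  where open ≡-Reasoning

prodFilterTo : (ℕ → Bool) → (ℕ → ℕ) → ℕ → ℕ
prodFilterTo q g n = product (map g (filterᵇ q (map (1 +_) (upTo n))))

prodFilterTo-snoc : ∀ q g n → prodFilterTo q g (suc n) ≡ prodFilterTo q g n * (if q (suc n) then g (suc n) else 1)
prodFilterTo-snoc q g n = begin
  product (map g (filterᵇ q (map (1 +_) (upTo (suc n)))))
    ≡⟨ cong (product ∘ map g) (trans (cong (filterᵇ q) (range-snoc 1 n)) (filter-++ (T? ∘ q) (map (1 +_) (upTo n)) [ suc n ])) ⟩
  product (map g (filterᵇ q (map (1 +_) (upTo n)) ++ filterᵇ q [ suc n ]))
    ≡⟨ cong product (map-++ g (filterᵇ q (map (1 +_) (upTo n))) (filterᵇ q [ suc n ])) ⟩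
  product (map g (filterᵇ q (map (1 +_) (upTo n))) ++ map g (filterᵇ q [ suc n ]))
    ≡⟨ product-++ (map g (filterᵇ q (map (1 +_) (upTo n)))) (map g (filterᵇ q [ suc n ])) ⟩
  prodFilterTo q g n * product (map g (filterᵇ q [ suc n ]))
    ≡⟨ cong (prodFilterTo q g n *_) last ⟩
  prodFilterTo q g n * (if q (suc n) then g (suc n) else 1) ∎
  where
  open ≡-Reasoning
  last : product (map g (filterᵇ q [ suc n ])) ≡ (if q (suc n) then g (suc n) else 1)
  last with q (suc n)
  ... | true  = *-identityʳ (g (suc n))
  ... | false = refl

prodTo-split-unmarked-step : ∀ f g C n P → C (suc n) ≡ false → f (suc n) ≡ g (suc n) →
  prodTo f n ≡ prodFilterTo (not ∘ C) g n * P → prodTo f (suc n) ≡ prodFilterTo (not ∘ C) g (suc n) * P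
prodTo-split-unmarked-step f g C n P unmarked f≡g IH = begin
  prodTo f (suc n)                                              ≡⟨ prodTo-snoc f n ⟩
  prodTo f n * f (suc n)                                        ≡⟨ cong₂ _*_ IH f≡g ⟩
  prodFilterTo (not ∘ C) g n * P * g (suc n)                    ≡⟨ *-xy∙z≈xz∙y (prodFilterTo (not ∘ C) g n) P (g (suc n)) ⟩
  prodFilterTo (not ∘ C) g n * g (suc n) * P
    ≡⟨ cong (λ b → prodFilterTo (not ∘ C) g n * (if not b then g (suc n) else 1) * P) (sym unmarked) ⟩
  prodFilterTo (not ∘ C) g n * (if not (C (suc n)) then g (suc n) else 1) * P
    ≡⟨ cong (_* P) (sym (prodFilterTo-snoc (not ∘ C) g n)) ⟩
  prodFilterTo (not ∘ C) g (suc n) * P                          ∎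
  where open ≡-Reasoning

prodTo-split-marked-step : ∀ f g C n P → C (suc n) ≡ true →
  prodTo f n ≡ prodFilterTo (not ∘ C) g n * P → prodTo f (suc n) ≡ prodFilterTo (not ∘ C) g (suc n) * (f (n + 1) * P)
prodTo-split-marked-step f g C n P marked IH = begin
  prodTo f (suc n)                                       ≡⟨ prodTo-snoc f n ⟩
  prodTo f n * f (suc n)                                 ≡⟨ cong₂ _*_ IH (cong f (+-comm 1 n)) ⟩
  prodFilterTo (not ∘ C) g n * P * f (n + 1)             ≡⟨ *-xy∙z≈x∙zy (prodFilterTo (not ∘ C) g n) P (f (n + 1)) ⟩
  prodFilterTo (not ∘ C) g n * (f (n + 1) * P)           ≡⟨ cong (_* (f (n + 1) * P)) (sym (*-identityʳ (prodFilterTo (not ∘ C) g n))) ⟩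
  prodFilterTo (not ∘ C) g n * 1 * (f (n + 1) * P)
    ≡⟨ cong (λ b → prodFilterTo (not ∘ C) g n * (if not b then g (suc n) else 1) * (f (n + 1) * P)) (sym marked) ⟩
  prodFilterTo (not ∘ C) g n * (if not (C (suc n)) then g (suc n) else 1) * (f (n + 1) * P)
    ≡⟨ cong (_* (f (n + 1) * P)) (sym (prodFilterTo-snoc (not ∘ C) g n)) ⟩
  prodFilterTo (not ∘ C) g (suc n) * (f (n + 1) * P)     ∎
  where open ≡-Reasoning

decreasing-below-suc : ∀ {n} cs → AllPairs _>_ cs → All (_< suc n) cs → All (_< n) cs ⊎ Σ (List ℕ) λ cs′ → cs ≡ n ∷ cs′
decreasing-below-suc []       _           _             = inj₁ []
decreasing-below-suc (c ∷ cs) (c>cs ∷ _) (s≤s c≤n ∷ _) with m≤n⇒m<n∨m≡n c≤n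
... | inj₁ c<n  = inj₁ (c<n ∷ All-map (λ c′<c → <-trans c′<c c<n) c>cs)
... | inj₂ refl = inj₂ (cs , refl)

prodTo-split-marked : ∀ (f g : ℕ → ℕ) (C : ℕ → Bool) n cs → AllPairs _>_ cs → All (_< n) cs →
  (∀ j → j ≤ n → C j ≡ any (λ c → c + 1 ≡ᵇ j) cs) →
  (∀ j → 1 ≤ j → j ≤ n → C j ≡ false → f j ≡ g j) →
  prodTo f n ≡ prodFilterTo (not ∘ C) g n * product (map (λ c → f (c + 1)) cs)
prodTo-split-marked f g C zero    []       _ _  _ _ = refl
prodTo-split-marked f g C zero    (_ ∷ _) _ (() ∷ _) _ _
prodTo-split-marked f g C (suc n) cs cs> cs<1+n C≡ f≡g with decreasing-below-suc cs cs> cs<1+n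
... | inj₁ cs<n = prodTo-split-unmarked-step f g C n _ unmarked (f≡g (suc n) (s≤s z≤n) ≤-refl unmarked)
  (prodTo-split-marked f g C n cs cs> cs<n (λ j j≤n → C≡ j (m≤n⇒m≤1+n j≤n)) (λ j 1≤j j≤n → f≡g j 1≤j (m≤n⇒m≤1+n j≤n)))
  where
  unmarked : C (suc n) ≡ false
  unmarked = trans (C≡ (suc n) ≤-refl) (any-none _ cs (All-map (λ {c} c<n → ≢⇒≡ᵇ≡false (λ c+1≡1+n →
    <-irrefl (suc-injective (trans (+-comm 1 c) c+1≡1+n)) c<n)) cs<n))
... | inj₂ (cs′ , refl) with cs>
... | n>cs′ ∷ cs′> = prodTo-split-marked-step f g C n _ marked
  (prodTo-split-marked f g C n cs′ cs′> n>cs′ C≡′ (λ j 1≤j j≤n → f≡g j 1≤j (m≤n⇒m≤1+n j≤n)))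
  where
  marked : C (suc n) ≡ true
  marked = trans (C≡ (suc n) ≤-refl) (cong (_∨ any (λ c → c + 1 ≡ᵇ suc n) cs′) (trans (cong (_≡ᵇ suc n) (+-comm n 1)) (≡ᵇ-refl (suc n))))
  C≡′ : ∀ j → j ≤ n → C j ≡ any (λ c → c + 1 ≡ᵇ j) cs′
  C≡′ j j≤n = trans (C≡ j (m≤n⇒m≤1+n j≤n))
    (cong (_∨ any (λ c → c + 1 ≡ᵇ j) cs′) (≢⇒≡ᵇ≡false (λ n+1≡j → 1+n≰n (subst (_≤ n) (sym (trans (+-comm 1 n) n+1≡j)) j≤n))))

prodTo-single : ∀ x M (k : ℕ → ℕ) → x ≤ M → prodTo (λ i → if x ≡ᵇ i then k i else 1) M ≡ (if x ≡ᵇ 0 then 1 else k x)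
prodTo-single .zero zero    k z≤n = refl
prodTo-single x     (suc M) k x≤1+M with m≤n⇒m<n∨m≡n x≤1+M
... | inj₁ (s≤s x≤M) = begin
  prodTo h (suc M)            ≡⟨ prodTo-snoc h M ⟩
  prodTo h M * h (suc M)      ≡⟨ cong (λ b → prodTo h M * (if b then k (suc M) else 1)) (≢⇒≡ᵇ≡false (<⇒≢ (s≤s x≤M))) ⟩
  prodTo h M * 1              ≡⟨ *-identityʳ (prodTo h M) ⟩
  prodTo h M                  ≡⟨ prodTo-single x M k x≤M ⟩
  (if x ≡ᵇ 0 then 1 else k x) ∎
  where
  open ≡-Reasoning
  h = λ i → if x ≡ᵇ i then k i else 1
... | inj₂ refl = begin
  prodTo h (suc M)            ≡⟨ prodTo-snoc h M ⟩
  prodTo h M * h (suc M)      ≡⟨ cong₂ _*_ (product-map-ones h _ (All-range 1 M h≡1)) (cong (λ b → if b then k (suc M) else 1) (≡ᵇ-refl M)) ⟩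
  1 * k (suc M)               ≡⟨ *-identityˡ (k (suc M)) ⟩
  k (suc M)                   ∎
  where
  open ≡-Reasoning
  h = λ i → if suc M ≡ᵇ i then k i else 1
  h≡1 : ∀ {i} → i < M → h (suc i) ≡ 1
  h≡1 {i} i<M = cong (λ b → if b then k (suc i) else 1) (≢⇒≡ᵇ≡false (>⇒≢ (s≤s i<M)))

mapCtx : {X B : Set} → (List X → X → List X → B) → List X → List X → List X → List B
mapCtx F pre []       post = []
mapCtx F pre (x ∷ xs) post = F pre x (xs ++ post) ∷ mapCtx F (pre ++ [ x ]) xs post

prodCtx : {X : Set} → (List X → X → List X → ℕ) → List X → List X → List X → ℕ
prodCtx F pre xs post = product (mapCtx F pre xs post)

mapCtx-entry : ∀ {X : Set} (pre xs post : List X) → mapCtx (λ _ x _ → x) pre xs post ≡ xs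
mapCtx-entry pre []       post = refl
mapCtx-entry pre (x ∷ xs) post = cong (x ∷_) (mapCtx-entry (pre ++ [ x ]) xs post)

mapCtx-++ : ∀ {X B : Set} (F : List X → X → List X → B) pre xs ys post →
  mapCtx F pre (xs ++ ys) post ≡ mapCtx F pre xs (ys ++ post) ++ mapCtx F (pre ++ xs) ys post
mapCtx-++ F pre []       ys post = cong (λ p → mapCtx F p ys post) (sym (++-identityʳ pre))
mapCtx-++ F pre (x ∷ xs) ys post = cong₂ _∷_ (cong (F pre x) (++-assoc xs ys post))
  (trans (mapCtx-++ F (pre ++ [ x ]) xs ys post) (cong (λ p → mapCtx F (pre ++ [ x ]) xs (ys ++ post) ++ mapCtx F p ys post) (∷ʳ-++ pre x xs)))

prodCtx-++ : ∀ {X : Set} (F : List X → X → List X → ℕ) pre xs ys post →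
  prodCtx F pre (xs ++ ys) post ≡ prodCtx F pre xs (ys ++ post) * prodCtx F (pre ++ xs) ys post
prodCtx-++ F pre xs ys post = trans (cong product (mapCtx-++ F pre xs ys post))
  (product-++ (mapCtx F pre xs (ys ++ post)) (mapCtx F (pre ++ xs) ys post))

prodCtx-cong : ∀ {X : Set} (F G : List X → X → List X → ℕ) pre xs post →
  All (λ x → ∀ a b → F a x b ≡ G a x b) xs → prodCtx F pre xs post ≡ prodCtx G pre xs post
prodCtx-cong F G pre []       post []       = refl
prodCtx-cong F G pre (x ∷ xs) post (e ∷ es) = cong₂ _*_ (e pre (xs ++ post)) (prodCtx-cong F G (pre ++ [ x ]) xs post es)

prodCtx-ones : ∀ {X : Set} (F : List X → X → List X → ℕ) pre xs post →
  All (λ x → ∀ a b → F a x b ≡ 1) xs → prodCtx F pre xs post ≡ 1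
prodCtx-ones F pre []       post []       = refl
prodCtx-ones F pre (x ∷ xs) post (e ∷ es) rewrite e pre (xs ++ post) =
  trans (+-identityʳ _) (prodCtx-ones F (pre ++ [ x ]) xs post es)

prodCtxRev : {X : Set} → (List X → X → List X → ℕ) → List X → List X → List X → ℕ
prodCtxRev F pre []       post = 1
prodCtxRev F pre (x ∷ xs) post = F (pre ++ reverse xs) x post * prodCtxRev F pre xs (x ∷ post)

prodCtx-reverse : ∀ {X : Set} (F : List X → X → List X → ℕ) pre xs post →
  prodCtx F pre (reverse xs) post ≡ prodCtxRev F pre xs post
prodCtx-reverse F pre []       post = refl
prodCtx-reverse F pre (x ∷ xs) post = begin
  prodCtx F pre (reverse (x ∷ xs)) post
    ≡⟨ cong (λ l → prodCtx F pre l post) (unfold-reverse x xs) ⟩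
  prodCtx F pre (reverse xs ++ [ x ]) post
    ≡⟨ prodCtx-++ F pre (reverse xs) [ x ] post ⟩
  prodCtx F pre (reverse xs) (x ∷ post) * (F (pre ++ reverse xs) x post * 1)
    ≡⟨ cong₂ _*_ (prodCtx-reverse F pre xs (x ∷ post)) (*-identityʳ _) ⟩
  prodCtxRev F pre xs (x ∷ post) * F (pre ++ reverse xs) x post
    ≡⟨ *-comm (prodCtxRev F pre xs (x ∷ post)) _ ⟩
  prodCtxRev F pre (x ∷ xs) post ∎
  where open ≡-Reasoning

prodCtx-tails : ∀ {X : Set} (Γ : X → List X → ℕ) pre xs → prodCtx (λ _ x post → Γ x post) pre xs [] ≡ prodTails Γ xs
prodCtx-tails Γ pre []       = refl
prodCtx-tails Γ pre (x ∷ xs) = cong₂ _*_ (cong (Γ x) (++-identityʳ xs)) (prodCtx-tails Γ (pre ++ [ x ]) xs)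

IsLookup₁ : {X : Set} → (List X → ℕ → X) → Set
IsLookup₁ {X} lk = ∀ (pre : List X) x ys → lk (pre ++ x ∷ ys) (suc (length pre)) ≡ x

at-isLookup₁ : IsLookup₁ at
at-isLookup₁ []           x ys = refl
at-isLookup₁ (y ∷ [])     x ys = refl
at-isLookup₁ (y ∷ z ∷ pre) x ys = at-isLookup₁ (z ∷ pre) x ys

atRow-isLookup₁ : IsLookup₁ atRow
atRow-isLookup₁ []            x ys = refl
atRow-isLookup₁ (y ∷ [])      x ys = refl
atRow-isLookup₁ (y ∷ z ∷ pre) x ys = atRow-isLookup₁ (z ∷ pre) x ys

inContext : {X B : Set} → (List X → ℕ → X) → (List X → X → List X → B) → List X → ℕ → B
inContext lk F η i = F (take (i ∸ 1) η) (lk η i) (drop i η)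

length-∷ʳ : ∀ {X : Set} (pre : List X) x → length (pre ++ [ x ]) ≡ suc (length pre)
length-∷ʳ pre x = trans (length-++ pre) (+-comm (length pre) 1)

take-length-++ : ∀ {X : Set} (pre ys : List X) → take (length pre) (pre ++ ys) ≡ pre
take-length-++ []        ys = refl
take-length-++ (x ∷ pre) ys = cong (x ∷_) (take-length-++ pre ys)

drop-suc-length-++ : ∀ {X : Set} (pre : List X) x ys → drop (suc (length pre)) (pre ++ x ∷ ys) ≡ ys
drop-suc-length-++ []        x ys = refl
drop-suc-length-++ (y ∷ pre) x ys = drop-suc-length-++ pre x ys

map-range-inContext : ∀ {X B : Set} (lk : List X → ℕ → X) → IsLookup₁ lk → (F : List X → X → List X → B) →
  ∀ η pre mid post → η ≡ pre ++ mid ++ post →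
  map (inContext lk F η) (map (suc (length pre) +_) (upTo (length mid))) ≡ mapCtx F pre mid post
map-range-inContext lk isLk F η pre []        post e = refl
map-range-inContext lk isLk F .(pre ++ x ∷ mid ++ post) pre (x ∷ mid) post refl =
  trans (cong (map (inContext lk F η)) (range-suc (suc (length pre)) (length mid)))
    (cong₂ _∷_ entry rest)
  where
  η = pre ++ x ∷ mid ++ post
  entry : inContext lk F η (suc (length pre)) ≡ F pre x (mid ++ post)
  entry = trans (cong₂ (λ p y → F p y (drop (suc (length pre)) η)) (take-length-++ pre (x ∷ mid ++ post)) (isLk pre x (mid ++ post)))
    (cong (F pre x) (drop-suc-length-++ pre x (mid ++ post)))
  rest : map (inContext lk F η) (map (suc (suc (length pre)) +_) (upTo (length mid))) ≡ mapCtx F (pre ++ [ x ]) mid post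
  rest = subst (λ n → map (inContext lk F η) (map (suc n +_) (upTo (length mid))) ≡ mapCtx F (pre ++ [ x ]) mid post)
    (length-∷ʳ pre x)
    (map-range-inContext lk isLk F η (pre ++ [ x ]) mid post (sym (∷ʳ-++ pre x (mid ++ post))))

map-lookup-range : ∀ {X : Set} (lk : List X → ℕ → X) → IsLookup₁ lk → ∀ η pre mid post → η ≡ pre ++ mid ++ post →
  map (lk η) (map (suc (length pre) +_) (upTo (length mid))) ≡ mid
map-lookup-range lk isLk η pre mid post e =
  trans (map-range-inContext lk isLk (λ _ x _ → x) η pre mid post e) (mapCtx-entry pre mid post)

map-lookup-take : ∀ {X : Set} (lk : List X → ℕ → X) → IsLookup₁ lk → ∀ η n → n ≤ length η →
  map (lk η) (map (1 +_) (upTo n)) ≡ take n η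
map-lookup-take lk isLk η n n≤ = subst (λ k → map (lk η) (map (1 +_) (upTo k)) ≡ take n η)
  (trans (length-take n η) (m≤n⇒m⊓n≡m n≤))
  (map-lookup-range lk isLk η [] (take n η) (drop n η) (sym (take++drop≡id n η)))

map-lookup-drop : ∀ {X : Set} (lk : List X → ℕ → X) → IsLookup₁ lk → ∀ η n → n ≤ length η →
  map (lk η) (map (suc n +_) (upTo (length η ∸ n))) ≡ drop n η
map-lookup-drop lk isLk η n n≤ = subst₂ (λ k l → map (lk η) (map (suc k +_) (upTo l)) ≡ drop n η)
  (trans (length-take n η) (m≤n⇒m⊓n≡m n≤)) (length-drop n η)
  (map-lookup-range lk isLk η (take n η) (drop n η) []
    (trans (sym (take++drop≡id n η)) (cong (take n η ++_) (sym (++-identityʳ (drop n η))))))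

inLeg′ : ℕ → ℕ → ℕ → Bool
inLeg′ j x y = (j ≤ᵇ y + 1) ∧ (y + 1 ≤ᵇ x)

inLeg″ : ℕ → ℕ → ℕ → Bool
inLeg″ j x y = (j ≤ᵇ y) ∧ (y ≤ᵇ x)

dCtx : ℕ → List ℕ → ℕ → List ℕ → ℕ → ℕ
dCtx α pre x post j = α * (x ∸ j + 1) + countᵇ (inLeg′ j x) pre + countᵇ (inLeg″ j x) post + 1

dC≡dCtx : ∀ α η i j → i ≤ length η → dC α η i j ≡ inContext at (λ pre x post → dCtx α pre x post j) η i
dC≡dCtx α η i j i≤ = cong₂ (λ u v → α * (at η i ∸ j + 1) + u + v + 1) leg′≡ leg″≡
  where
  leg′≡ : leg′ η i j ≡ countᵇ (inLeg′ j (at η i)) (take (i ∸ 1) η)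
  leg′≡ = trans (sym (countᵇ-map (inLeg′ j (at η i)) (at η) (map (1 +_) (upTo (i ∸ 1)))))
    (cong (countᵇ (inLeg′ j (at η i))) (map-lookup-take at at-isLookup₁ η (i ∸ 1) (≤-trans (m∸n≤m i 1) i≤)))
  leg″≡ : leg″ η i j ≡ countᵇ (inLeg″ j (at η i)) (drop i η)
  leg″≡ = trans (sym (countᵇ-map (inLeg″ j (at η i)) (at η) (map (suc i +_) (upTo (length η ∸ i)))))
    (cong (countᵇ (inLeg″ j (at η i))) (map-lookup-drop at at-isLookup₁ η i i≤))

cellProd : ℕ → List ℕ → ℕ → List ℕ → ℕ
cellProd α pre x post = prodTo (dCtx α pre x post) x

lhsNum≡prodCtx : ∀ α Λa Λs → lhsNum α Λa Λs ≡ prodCtx (cellProd α) [] (tilde Λa Λs) []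
lhsNum≡prodCtx α Λa Λs = begin
  lhsNum α Λa Λs
    ≡⟨ product-map-concatMap d (λ i → map (i ,_) (map (1 +_) (upTo (at η i)))) rows ⟩
  product (map (λ i → product (map d (map (i ,_) (map (1 +_) (upTo (at η i)))))) rows)
    ≡⟨ cong product (range-cong 1 (length η) row≡) ⟩
  product (map (inContext at (cellProd α) η) rows)
    ≡⟨ cong product (map-range-inContext at at-isLookup₁ (cellProd α) η [] η [] (sym (++-identityʳ η))) ⟩
  prodCtx (cellProd α) [] η [] ∎
  where
  open ≡-Reasoning
  η = tilde Λa Λs
  d = λ (s : ℕ × ℕ) → dC α η (proj₁ s) (proj₂ s)
  rows = map (1 +_) (upTo (length η))
  row≡ : ∀ {i} → i < length η → product (map d (map (suc i ,_) (map (1 +_) (upTo (at η (suc i))))))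
                                   ≡ inContext at (cellProd α) η (suc i)
  row≡ {i} i< = trans (product-map-∘ d (suc i ,_) cols)
    (cong product (map-cong (λ j → dC≡dCtx α η (suc i) j i<) cols))
    where cols = map (1 +_) (upTo (at η (suc i)))

circleColProd : ℕ → List ℕ → ℕ → List ℕ → ℕ
circleColProd α pre x post = product (map (λ y → dCtx α pre x post (y + 1)) pre)

rhsCircles≡prodCtx : ∀ α Λa Λs →
  product (concatMap (λ i → map (λ j → dC α (tilde Λa Λs) i (at (tilde Λa Λs) j + 1)) (interval 1 (i ∸ 1))) (interval 1 (length Λa)))
  ≡ prodCtx (circleColProd α) [] (reverse Λa) (reverse Λs)
rhsCircles≡prodCtx α Λa Λs = begin
  product (concatMap row rows)
    ≡⟨ product-concatMap row rows ⟩
  product (map (product ∘ row) rows)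
    ≡⟨ cong (λ n → product (map (product ∘ row) (map (1 +_) (upTo n)))) (sym (length-reverse Λa)) ⟩
  product (map (product ∘ row) (map (1 +_) (upTo (length (reverse Λa)))))
    ≡⟨ cong product (range-cong 1 (length (reverse Λa)) row≡) ⟩
  product (map (inContext at (circleColProd α) η) (map (1 +_) (upTo (length (reverse Λa)))))
    ≡⟨ cong product (map-range-inContext at at-isLookup₁ (circleColProd α) η [] (reverse Λa) (reverse Λs) refl) ⟩
  prodCtx (circleColProd α) [] (reverse Λa) (reverse Λs) ∎
  where
  open ≡-Reasoning
  η = tilde Λa Λs
  row = λ i → map (λ j → dC α η i (at η j + 1)) (interval 1 (i ∸ 1))
  rows = interval 1 (length Λa)
  row≡ : ∀ {i} → i < length (reverse Λa) → product (row (suc i)) ≡ inContext at (circleColProd α) η (suc i)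
  row≡ {i} i< = begin
    product (map (λ j → dC α η (suc i) (at η j + 1)) (map (1 +_) (upTo i)))
      ≡⟨ cong product (map-∘ (map (1 +_) (upTo i))) ⟩
    product (map (λ y → dC α η (suc i) (y + 1)) (map (at η) (map (1 +_) (upTo i))))
      ≡⟨ cong (λ l → product (map (λ y → dC α η (suc i) (y + 1)) l)) (map-lookup-take at at-isLookup₁ η i (<⇒≤ i<η)) ⟩
    product (map (λ y → dC α η (suc i) (y + 1)) (take i η))
      ≡⟨ cong product (map-cong (λ y → dC≡dCtx α η (suc i) (y + 1) i<η) (take i η)) ⟩
    inContext at (circleColProd α) η (suc i) ∎
    where
    i<η : i < length η
    i<η = <-≤-trans i< (subst (length (reverse Λa) ≤_) (sym (length-++ (reverse Λa))) (m≤m+n _ _))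

firstCell : ℕ → List ℕ → ℕ → List ℕ → ℕ
firstCell α pre x post = if x ≡ᵇ 0 then 1 else dCtx α pre x post 1

nonzeros-then-zeros : ∀ S → AllPairs _≥_ S → Σ (List ℕ) λ P → Σ (List ℕ) λ Zs →
  S ≡ P ++ Zs × All (λ x → (x ≡ᵇ 0) ≡ false) P × All (λ x → (x ≡ᵇ 0) ≡ true) Zs
nonzeros-then-zeros []          []       = [] , [] , refl , [] , []
nonzeros-then-zeros (zero ∷ S)  (h ∷ hs) = [] , zero ∷ S , refl , [] , refl ∷ All-map (λ { z≤n → refl }) h
nonzeros-then-zeros (suc k ∷ S) (h ∷ hs) with nonzeros-then-zeros S hs
... | P , Zs , refl , P≢0 , Zs≡0 = suc k ∷ P , Zs , refl , refl ∷ P≢0 , Zs≡0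

ellS-nonzeros-then-zeros : ∀ P Zs → All (λ x → (x ≡ᵇ 0) ≡ false) P → All (λ x → (x ≡ᵇ 0) ≡ true) Zs →
  ellS (P ++ Zs) ≡ length P
ellS-nonzeros-then-zeros P Zs P≢0 Zs≡0 = begin
  ellS (P ++ Zs)                  ≡⟨ countᵇ-++ nz P Zs ⟩
  countᵇ nz P + countᵇ nz Zs      ≡⟨ cong₂ _+_ (countᵇ-every nz P (All-map (cong not) P≢0)) (countᵇ-none nz Zs (All-map (cong not) Zs≡0)) ⟩
  length P + 0                    ≡⟨ +-identityʳ (length P) ⟩
  length P                        ∎
  where
  open ≡-Reasoning
  nz = λ x → not (x ≡ᵇ 0)

tilde-nonzeros-then-zeros : ∀ (A P Zs : List ℕ) → tilde A (P ++ Zs) ≡ (reverse A ++ reverse Zs) ++ reverse P ++ []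
tilde-nonzeros-then-zeros A P Zs = begin
  reverse A ++ reverse (P ++ Zs)               ≡⟨ cong (reverse A ++_) (reverse-++ P Zs) ⟩
  reverse A ++ reverse Zs ++ reverse P         ≡⟨ sym (++-assoc (reverse A) (reverse Zs) (reverse P)) ⟩
  (reverse A ++ reverse Zs) ++ reverse P       ≡⟨ cong ((reverse A ++ reverse Zs) ++_) (sym (++-identityʳ (reverse P))) ⟩
  (reverse A ++ reverse Zs) ++ reverse P ++ [] ∎
  where open ≡-Reasoning

length-tilde-nonzeros-then-zeros : ∀ (A P Zs : List ℕ) →
  length (tilde A (P ++ Zs)) ≡ length (reverse A ++ reverse Zs) + length (reverse P)
length-tilde-nonzeros-then-zeros A P Zs = begin
  length (tilde A (P ++ Zs))                            ≡⟨ cong length (tilde-nonzeros-then-zeros A P Zs) ⟩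
  length ((reverse A ++ reverse Zs) ++ reverse P ++ []) ≡⟨ length-++ (reverse A ++ reverse Zs) ⟩
  length (reverse A ++ reverse Zs) + length (reverse P ++ []) ≡⟨ cong (λ l → length (reverse A ++ reverse Zs) + length l) (++-identityʳ (reverse P)) ⟩
  length (reverse A ++ reverse Zs) + length (reverse P) ∎
  where open ≡-Reasoning

-- The last ℓ(Λs) rows of Λ̃ are the nonzero symmetric entries.
interval-nonzeros : ∀ A P Zs → All (λ x → (x ≡ᵇ 0) ≡ false) P → All (λ x → (x ≡ᵇ 0) ≡ true) Zs →
  interval (suc ((length A + length (P ++ Zs)) ∸ ellS (P ++ Zs))) (length A + length (P ++ Zs))
  ≡ map (suc (length (reverse A ++ reverse Zs)) +_) (upTo (length (reverse P)))
interval-nonzeros A P Zs P≢0 Zs≡0 = cong₂ (λ a b → map (suc a +_) (upTo b)) N∸ℓ≡L N∸[N∸ℓ]≡p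
  where
  open ≡-Reasoning
  N = length A + length (P ++ Zs)
  L = length (reverse A ++ reverse Zs)
  p = length (reverse P)
  N≡L+p : N ≡ L + p
  N≡L+p = begin
    length A + length (P ++ Zs)                          ≡⟨ cong₂ _+_ (sym (length-reverse A)) (sym (length-reverse (P ++ Zs))) ⟩
    length (reverse A) + length (reverse (P ++ Zs))      ≡⟨ sym (length-++ (reverse A)) ⟩
    length (tilde A (P ++ Zs))                           ≡⟨ length-tilde-nonzeros-then-zeros A P Zs ⟩
    L + p                                                ∎
  ℓ≡p : ellS (P ++ Zs) ≡ p
  ℓ≡p = trans (ellS-nonzeros-then-zeros P Zs P≢0 Zs≡0) (sym (length-reverse P))
  N∸ℓ≡L : N ∸ ellS (P ++ Zs) ≡ L
  N∸ℓ≡L = trans (cong₂ _∸_ N≡L+p ℓ≡p) (m+n∸n≡m L p)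
  N∸[N∸ℓ]≡p : N ∸ (N ∸ ellS (P ++ Zs)) ≡ p
  N∸[N∸ℓ]≡p = trans (cong₂ _∸_ N≡L+p N∸ℓ≡L) (m+n∸m≡n L p)

prodCtx-firstCell-zeros : ∀ α pre P Zs → All (λ x → (x ≡ᵇ 0) ≡ false) P → All (λ x → (x ≡ᵇ 0) ≡ true) Zs →
  prodCtx (firstCell α) pre (reverse (P ++ Zs)) [] ≡ prodCtx (λ pre x post → dCtx α pre x post 1) (pre ++ reverse Zs) (reverse P) []
prodCtx-firstCell-zeros α pre P Zs P≢0 Zs≡0 = begin
  prodCtx (firstCell α) pre (reverse (P ++ Zs)) []
    ≡⟨ cong (λ l → prodCtx (firstCell α) pre l []) (reverse-++ P Zs) ⟩
  prodCtx (firstCell α) pre (reverse Zs ++ reverse P) []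
    ≡⟨ prodCtx-++ (firstCell α) pre (reverse Zs) (reverse P) [] ⟩
  prodCtx (firstCell α) pre (reverse Zs) (reverse P ++ []) * prodCtx (firstCell α) (pre ++ reverse Zs) (reverse P) []
    ≡⟨ cong₂ _*_ (prodCtx-ones (firstCell α) pre (reverse Zs) _ (All-reverse (All-map by-zero-test Zs≡0)))
                 (prodCtx-cong (firstCell α) first _ (reverse P) [] (All-reverse (All-map by-zero-test P≢0))) ⟩
  1 * prodCtx first (pre ++ reverse Zs) (reverse P) []
    ≡⟨ *-identityˡ _ ⟩
  prodCtx first (pre ++ reverse Zs) (reverse P) [] ∎
  where
  open ≡-Reasoning
  first = λ pre x post → dCtx α pre x post 1
  by-zero-test : ∀ {x b} → (x ≡ᵇ 0) ≡ b → ∀ pre post → firstCell α pre x post ≡ (if b then 1 else first pre x post)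
  by-zero-test {x} e pre post = cong (λ c → if c then 1 else first pre x post) e

rhsFirst≡prodCtx : ∀ α Λa Λs → AllPairs _≥_ Λs →
  product (map (λ i → dC α (tilde Λa Λs) i 1) (interval (suc ((length Λa + length Λs) ∸ ellS Λs)) (length Λa + length Λs)))
  ≡ prodCtx (firstCell α) (reverse Λa) (reverse Λs) []
rhsFirst≡prodCtx α A S S≥ with nonzeros-then-zeros S S≥
... | P , Zs , refl , P≢0 , Zs≡0 = begin
  product (map (λ i → dC α η i 1) (interval (suc ((length A + length (P ++ Zs)) ∸ ellS (P ++ Zs))) (length A + length (P ++ Zs))))
    ≡⟨ cong (product ∘ map (λ i → dC α η i 1)) (interval-nonzeros A P Zs P≢0 Zs≡0) ⟩
  product (map (λ i → dC α η i 1) (map (suc L +_) (upTo p)))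
    ≡⟨ cong product (range-cong (suc L) p (λ {i} i<p → dC≡dCtx α η (suc L + i) 1 (suc-L+i≤η i<p))) ⟩
  product (map (inContext at first η) (map (suc L +_) (upTo p)))
    ≡⟨ cong product (map-range-inContext at at-isLookup₁ first η (reverse A ++ reverse Zs) (reverse P) [] (tilde-nonzeros-then-zeros A P Zs)) ⟩
  prodCtx first (reverse A ++ reverse Zs) (reverse P) []
    ≡⟨ sym (prodCtx-firstCell-zeros α (reverse A) P Zs P≢0 Zs≡0) ⟩
  prodCtx (firstCell α) (reverse A) (reverse (P ++ Zs)) [] ∎
  where
  open ≡-Reasoning
  η = tilde A (P ++ Zs)
  L = length (reverse A ++ reverse Zs)
  p = length (reverse P)
  first = λ pre x post → dCtx α pre x post 1
  suc-L+i≤η : ∀ {i} → i < p → suc L + i ≤ length η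
  suc-L+i≤η {i} i<p = subst (suc L + i ≤_) (sym (length-tilde-nonzeros-then-zeros A P Zs)) (+-monoʳ-< L i<p)

inLeg′-≥ : ∀ j {x y} → x ≤ y → inLeg′ j x y ≡ false
inLeg′-≥ j {x} {y} x≤y = trans (cong ((j ≤ᵇ y + 1) ∧_) (>⇒≤ᵇ≡false (subst (x <_) (+-comm 1 y) (s≤s x≤y)))) (∧-zeroʳ _)

inLeg″-> : ∀ j {x y} → x < y → inLeg″ j x y ≡ false
inLeg″-> j {x} {y} x<y = trans (cong ((j ≤ᵇ y) ∧_) (>⇒≤ᵇ≡false x<y)) (∧-zeroʳ _)

inLeg″-≥ : ∀ {j x y} → j ≤ x → x ≤ y → inLeg″ j x y ≡ (y ≡ᵇ x)
inLeg″-≥ {j} {x} {y} j≤x x≤y with m≤n⇒m<n∨m≡n x≤y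
... | inj₁ x<y = trans (inLeg″-> j x<y) (sym (≢⇒≡ᵇ≡false (>⇒≢ x<y)))
... | inj₂ refl rewrite ≤⇒≤ᵇ≡true j≤x | ≤⇒≤ᵇ≡true (≤-refl {x}) = sym (≡ᵇ-refl x)

countᵇ-inLeg′-longer : ∀ j B x xs → All (x ≤_) B → countᵇ (inLeg′ j x) (B ++ x ∷ xs) ≡ countᵇ (inLeg′ j x) xs
countᵇ-inLeg′-longer j B x xs x≤B = begin
  countᵇ (inLeg′ j x) (B ++ x ∷ xs)                    ≡⟨ countᵇ-++ (inLeg′ j x) B (x ∷ xs) ⟩
  countᵇ (inLeg′ j x) B + countᵇ (inLeg′ j x) (x ∷ xs) ≡⟨ cong₂ (λ m b → m + (indicator b + countᵇ (inLeg′ j x) xs))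
                                                             (countᵇ-none (inLeg′ j x) B (All-map (inLeg′-≥ j) x≤B)) (inLeg′-≥ j ≤-refl) ⟩
  countᵇ (inLeg′ j x) xs                               ∎
  where open ≡-Reasoning

-- In Λ̃ an antisymmetric row a has the smaller antisymmetric rows before it and the larger ones and
-- all symmetric rows after it; only the smaller ones count towards l′ and only Λs towards l″.
dCtx-antisymmetric : ∀ α S B x xs j → All (x <_) B →
  dCtx α (reverse xs) x (reverse B ++ reverse S) j ≡ dCtx α (B ++ x ∷ xs) x S j
dCtx-antisymmetric α S B x xs j x<B = cong₂ (λ u v → α * (x ∸ j + 1) + u + v + 1) leg′≡ leg″≡
  where
  open ≡-Reasoning
  leg′≡ : countᵇ (inLeg′ j x) (reverse xs) ≡ countᵇ (inLeg′ j x) (B ++ x ∷ xs)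
  leg′≡ = trans (countᵇ-reverse (inLeg′ j x) xs) (sym (countᵇ-inLeg′-longer j B x xs (All-map <⇒≤ x<B)))
  leg″≡ : countᵇ (inLeg″ j x) (reverse B ++ reverse S) ≡ countᵇ (inLeg″ j x) S
  leg″≡ = begin
    countᵇ (inLeg″ j x) (reverse B ++ reverse S)             ≡⟨ countᵇ-++ (inLeg″ j x) (reverse B) (reverse S) ⟩
    countᵇ (inLeg″ j x) (reverse B) + countᵇ (inLeg″ j x) (reverse S) ≡⟨ cong₂ _+_ (countᵇ-reverse (inLeg″ j x) B) (countᵇ-reverse (inLeg″ j x) S) ⟩
    countᵇ (inLeg″ j x) B + countᵇ (inLeg″ j x) S            ≡⟨ cong (_+ countᵇ (inLeg″ j x) S) (countᵇ-none (inLeg″ j x) B (All-map (inLeg″-> j) x<B)) ⟩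
    countᵇ (inLeg″ j x) S                                    ∎

prodCtxRev-antisymmetric : ∀ α (A S : List ℕ) (G : (ℕ → ℕ) → ℕ → List ℕ → ℕ) →
  (∀ {h h′} x pre → (∀ j → h j ≡ h′ j) → G h x pre ≡ G h′ x pre) →
  ∀ B xs post → B ++ xs ≡ A → post ≡ reverse B ++ reverse S → AllPairs _>_ xs → All (λ b → All (_< b) xs) B →
  prodCtxRev (λ pre x post → G (dCtx α pre x post) x pre) [] xs post ≡ prodTails (λ a as → G (dCtx α A a S) a (reverse as)) xs
prodCtxRev-antisymmetric α A S G G-cong B []       post _    _    _          _   = refl
prodCtxRev-antisymmetric α A S G G-cong B (x ∷ xs) post refl refl (x>xs ∷ xs>) B>xxs =
  cong₂ _*_ (G-cong x (reverse xs) (λ j → dCtx-antisymmetric α S B x xs j (All-map (λ { (x<b ∷ _) → x<b }) B>xxs)))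
    (prodCtxRev-antisymmetric α (B ++ x ∷ xs) S G G-cong (B ++ [ x ]) xs (x ∷ reverse B ++ reverse S)
      (∷ʳ-++ B x xs) (cong (_++ reverse S) (sym (reverse-++ B [ x ]))) xs>
      (++⁺ (All-map (λ { (_ ∷ xs<b) → xs<b }) B>xxs) (x>xs ∷ [])))

-- The d-value of a cell (s, j) in a symmetric row, where t rows of the same length follow it in Λ̃.
dSym : ℕ → List ℕ → List ℕ → ℕ → ℕ → ℕ → ℕ
dSym α A S s t j = α * (s ∸ j + 1) + (countᵇ (inLeg′ j s) A + countᵇ (inLeg′ j s) S) + t + 1

dCtx-symmetric : ∀ α A B x xs j → j ≤ x → All (x ≤_) B →
  dCtx α (reverse A ++ reverse xs) x (reverse B) j ≡ dSym α A (B ++ x ∷ xs) x (mult x (reverse B)) j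
dCtx-symmetric α A B x xs j j≤x x≤B = cong₂ (λ u v → α * (x ∸ j + 1) + u + v + 1) leg′≡ leg″≡
  where
  open ≡-Reasoning
  leg′≡ : countᵇ (inLeg′ j x) (reverse A ++ reverse xs) ≡ countᵇ (inLeg′ j x) A + countᵇ (inLeg′ j x) (B ++ x ∷ xs)
  leg′≡ = begin
    countᵇ (inLeg′ j x) (reverse A ++ reverse xs)     ≡⟨ countᵇ-++ (inLeg′ j x) (reverse A) (reverse xs) ⟩
    countᵇ (inLeg′ j x) (reverse A) + countᵇ (inLeg′ j x) (reverse xs) ≡⟨ cong₂ _+_ (countᵇ-reverse (inLeg′ j x) A) (countᵇ-reverse (inLeg′ j x) xs) ⟩
    countᵇ (inLeg′ j x) A + countᵇ (inLeg′ j x) xs    ≡⟨ cong (countᵇ (inLeg′ j x) A +_) (sym (countᵇ-inLeg′-longer j B x xs x≤B)) ⟩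
    countᵇ (inLeg′ j x) A + countᵇ (inLeg′ j x) (B ++ x ∷ xs) ∎
  leg″≡ : countᵇ (inLeg″ j x) (reverse B) ≡ mult x (reverse B)
  leg″≡ = countᵇ-cong (inLeg″ j x) (_≡ᵇ x) (reverse B) (All-map (inLeg″-≥ j≤x) (All-reverse x≤B))

prodCtxRev-symmetric : ∀ α (A S : List ℕ) (G : (ℕ → ℕ) → ℕ → ℕ) →
  (∀ {h h′} x → (∀ j → 1 ≤ j → j ≤ x → h j ≡ h′ j) → G h x ≡ G h′ x) →
  ∀ B xs post → B ++ xs ≡ S → post ≡ reverse B → AllPairs _≥_ xs → All (λ b → All (_≤ b) xs) B →
  prodCtxRev (λ pre x post → G (dCtx α pre x post) x) (reverse A) xs post ≡ prodOccBefore (λ s t → G (dSym α A S s t) s) post xs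
prodCtxRev-symmetric α A S G G-cong B []       post _    _    _          _   = refl
prodCtxRev-symmetric α A S G G-cong B (x ∷ xs) post refl refl (x≥xs ∷ xs≥) B≥xxs =
  cong₂ _*_ (G-cong x (λ j _ j≤x → dCtx-symmetric α A B x xs j j≤x (All-map (λ { (x≤b ∷ _) → x≤b }) B≥xxs)))
    (prodCtxRev-symmetric α A (B ++ x ∷ xs) G G-cong (B ++ [ x ]) xs (x ∷ reverse B)
      (∷ʳ-++ B x xs) (sym (reverse-++ B [ x ])) xs≥
      (++⁺ (All-map (λ { (_ ∷ xs≤b) → xs≤b }) B≥xxs) (x≥xs ∷ [])))

-- Ties go to the circled row, as in D[Λ].
mergeRows : List ℕ → List ℕ → List (ℕ × Bool)
mergeRows []       ss       = map (_, false) ss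
mergeRows (a ∷ as) []       = (a , true) ∷ mergeRows as []
mergeRows (a ∷ as) (s ∷ ss) = if s ≤ᵇ a then (a , true) ∷ mergeRows as (s ∷ ss) else (s , false) ∷ mergeRows (a ∷ as) ss

All-mergeRows : ∀ {P : ℕ × Bool → Set} as ss → All (λ a → P (a , true)) as → All (λ s → P (s , false)) ss →
  All P (mergeRows as ss)
All-mergeRows []       []       _          _          = []
All-mergeRows []       (s ∷ ss) _          (ps ∷ pss) = ps ∷ All-mergeRows [] ss [] pss
All-mergeRows (a ∷ as) []       (pa ∷ pas) _          = pa ∷ All-mergeRows as [] pas []
All-mergeRows {P} (a ∷ as) (s ∷ ss) (pa ∷ pas) (ps ∷ pss) = if-intro {P = All P} (s ≤ᵇ a)
  (λ _ → pa ∷ All-mergeRows as (s ∷ ss) pas (ps ∷ pss))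
  (λ _ → ps ∷ All-mergeRows (a ∷ as) ss (pa ∷ pas) pss)

mergeRows-longer : ∀ as s ss → All (_< s) as → mergeRows as (s ∷ ss) ≡ (s , false) ∷ mergeRows as ss
mergeRows-longer []       s ss _            = refl
mergeRows-longer (a ∷ as) s ss (a<s ∷ _) rewrite >⇒≤ᵇ≡false a<s = refl

before-circled : ∀ {a l} c → l ≤ a → before (a , true) (l , c) ≡ true
before-circled {a} {l} c l≤a with m≤n⇒m<n∨m≡n l≤a
... | inj₁ l<a  rewrite <⇒<ᵇ≡true l<a = refl
... | inj₂ refl rewrite ≥⇒<ᵇ≡false (≤-refl {l}) | ≡ᵇ-refl l = refl

before-circled-shorter : ∀ {a s} → a < s → before (a , true) (s , false) ≡ false
before-circled-shorter {a} {s} a<s rewrite ≥⇒<ᵇ≡false (<⇒≤ a<s) | ≢⇒≡ᵇ≡false (<⇒≢ a<s) = refl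

insertRow-after : ∀ {x y ys} → before x y ≡ false → insertRow x (y ∷ ys) ≡ y ∷ insertRow x ys
insertRow-after {x} {y} {ys} e = cong (λ b → if b then x ∷ y ∷ ys else y ∷ insertRow x ys) e

insertRow-circled-longest : ∀ a R → All (λ r → proj₁ r ≤ a) R → insertRow (a , true) R ≡ (a , true) ∷ R
insertRow-circled-longest a []              _          = refl
insertRow-circled-longest a ((l , c) ∷ R) (l≤a ∷ _) rewrite before-circled c l≤a = refl

insertRow-circled : ∀ a as ss → All (_< a) as → AllPairs _≥_ ss → insertRow (a , true) (mergeRows as ss) ≡ mergeRows (a ∷ as) ss
insertRow-circled a as []       as<a _ = insertRow-circled-longest a (mergeRows as []) (All-mergeRows as [] (All-map <⇒≤ as<a) [])
insertRow-circled a as (s ∷ ss) as<a (s≥ss ∷ ss≥) with s ≤ᵇ a in s≤ᵇa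
... | true  = insertRow-circled-longest a (mergeRows as (s ∷ ss))
                (All-mergeRows as (s ∷ ss) (All-map <⇒≤ as<a) (s≤a ∷ All-map (λ s′≤s → ≤-trans s′≤s s≤a) s≥ss))
  where s≤a = ≤ᵇ≡true⇒≤ s≤ᵇa
... | false = begin
  insertRow (a , true) (mergeRows as (s ∷ ss))
    ≡⟨ cong (insertRow (a , true)) (mergeRows-longer as s ss (All-map (λ a′<a → <-trans a′<a a<s) as<a)) ⟩
  insertRow (a , true) ((s , false) ∷ mergeRows as ss)
    ≡⟨ insertRow-after (before-circled-shorter a<s) ⟩
  (s , false) ∷ insertRow (a , true) (mergeRows as ss)
    ≡⟨ cong ((s , false) ∷_) (insertRow-circled a as ss as<a ss≥) ⟩
  (s , false) ∷ mergeRows (a ∷ as) ss ∎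
  where
  open ≡-Reasoning
  a<s = ≰⇒> (λ s≤a → contradiction (trans (sym (≤⇒≤ᵇ≡true s≤a)) s≤ᵇa) λ ())

insertRow-uncircled-longest : ∀ s S → All (_≤ s) S → AllPairs _≥_ S →
  insertRow (s , false) (map (_, false) S) ≡ (s , false) ∷ map (_, false) S
insertRow-uncircled-longest s []       _           _           = refl
insertRow-uncircled-longest s (s′ ∷ S) (s′≤s ∷ _) (s′≥S ∷ S≥) with m≤n⇒m<n∨m≡n s′≤s
... | inj₁ s′<s rewrite <⇒<ᵇ≡true s′<s = refl
... | inj₂ refl rewrite ≥⇒<ᵇ≡false (≤-refl {s}) | ∧-zeroʳ (s ≡ᵇ s) =
  cong ((s , false) ∷_) (insertRow-uncircled-longest s S s′≥S S≥)

sortRows-uncircled : ∀ S → AllPairs _≥_ S → sortRows (map (_, false) S) ≡ map (_, false) S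
sortRows-uncircled []      []          = refl
sortRows-uncircled (s ∷ S) (s≥S ∷ S≥) =
  trans (cong (insertRow (s , false)) (sortRows-uncircled S S≥)) (insertRow-uncircled-longest s S s≥S S≥)

rowsD≡mergeRows : ∀ A S → AllPairs _>_ A → AllPairs _≥_ S → rowsD A S ≡ mergeRows A S
rowsD≡mergeRows A S A> S≥ = begin
  foldr insertRow [] (map (_, true) A ++ map (_, false) S)       ≡⟨ foldr-++ insertRow [] (map (_, true) A) (map (_, false) S) ⟩
  foldr insertRow (sortRows (map (_, false) S)) (map (_, true) A) ≡⟨ cong (λ R → foldr insertRow R (map (_, true) A)) (sortRows-uncircled S S≥) ⟩
  foldr insertRow (map (_, false) S) (map (_, true) A)            ≡⟨ insert-circled A A> ⟩
  mergeRows A S                                                   ∎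
  where
  open ≡-Reasoning
  insert-circled : ∀ A → AllPairs _>_ A → foldr insertRow (map (_, false) S) (map (_, true) A) ≡ mergeRows A S
  insert-circled []      []          = refl
  insert-circled (a ∷ A) (a>A ∷ A>) =
    trans (cong (insertRow (a , true)) (insert-circled A A>)) (insertRow-circled a A S a>A S≥)

countᵇ-mergeRows : ∀ p as ss → countᵇ p (map proj₁ (mergeRows as ss)) ≡ countᵇ p as + countᵇ p ss
countᵇ-mergeRows p []       ss       = cong (countᵇ p) (trans (sym (map-∘ ss)) (map-id ss))
countᵇ-mergeRows p (a ∷ as) []       = trans (cong (indicator (p a) +_) (countᵇ-mergeRows p as []))
                                          (sym (+-assoc (indicator (p a)) (countᵇ p as) 0))
countᵇ-mergeRows p (a ∷ as) (s ∷ ss) = if-intro {P = λ R → countᵇ p (map proj₁ R) ≡ countᵇ p (a ∷ as) + countᵇ p (s ∷ ss)} (s ≤ᵇ a)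
  (λ _ → trans (cong (indicator (p a) +_) (countᵇ-mergeRows p as (s ∷ ss))) (sym (+-assoc (indicator (p a)) _ _)))
  (λ _ → trans (cong (indicator (p s) +_) (countᵇ-mergeRows p (a ∷ as) ss)) (+-x∙yz≈y∙xz (indicator (p s)) (countᵇ p (a ∷ as)) _))

any-mergeRows : ∀ (f : ℕ → Bool) as ss → any (λ r → proj₂ r ∧ f (proj₁ r)) (mergeRows as ss) ≡ any f as
any-mergeRows f []       ss       = uncircled ss
  where
  uncircled : ∀ ss → any (λ r → proj₂ r ∧ f (proj₁ r)) (map (_, false) ss) ≡ false
  uncircled []       = refl
  uncircled (s ∷ ss) = uncircled ss
any-mergeRows f (a ∷ as) []       = cong (f a ∨_) (any-mergeRows f as [])
any-mergeRows f (a ∷ as) (s ∷ ss) = if-intro {P = λ R → any (λ r → proj₂ r ∧ f (proj₁ r)) R ≡ any f (a ∷ as)} (s ≤ᵇ a)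
  (λ _ → cong (f a ∨_) (any-mergeRows f as (s ∷ ss)))
  (λ _ → any-mergeRows f (a ∷ as) ss)

colCirc≡ : ∀ A S j → AllPairs _>_ A → AllPairs _≥_ S → colCirc A S j ≡ any (λ b → b + 1 ≡ᵇ j) A
colCirc≡ A S j A> S≥ = begin
  any (f ∘ atRow R) (map (1 +_) (upTo (length R)))     ≡⟨ cong or (map-∘ (map (1 +_) (upTo (length R)))) ⟩
  any f (map (atRow R) (map (1 +_) (upTo (length R)))) ≡⟨ cong (any f) (map-lookup-take atRow atRow-isLookup₁ R (length R) ≤-refl) ⟩
  any f (take (length R) R)                            ≡⟨ cong (any f) (take-all (length R) R ≤-refl) ⟩
  any f R                                              ≡⟨ cong (any f) (rowsD≡mergeRows A S A> S≥) ⟩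
  any f (mergeRows A S)                                ≡⟨ any-mergeRows (λ l → l + 1 ≡ᵇ j) A S ⟩
  any (λ b → b + 1 ≡ᵇ j) A                             ∎
  where
  open ≡-Reasoning
  R = rowsD A S
  f = λ (r : ℕ × Bool) → proj₂ r ∧ (proj₁ r + 1 ≡ᵇ j)

hook : ℕ → ℕ × Bool → List (ℕ × Bool) → ℕ → ℕ
hook α row below j = α * (proj₁ row ∸ j + indicator (proj₂ row)) + countᵇ (j ≤ᵇ_) (map proj₁ below) + 1

rowHookProd : ℕ → (ℕ → Bool) → ℕ × Bool → List (ℕ × Bool) → ℕ
rowHookProd α circledCol row below =
  product (map (hook α row below) (filterᵇ (λ j → not (proj₂ row ∧ circledCol j)) (map (1 +_) (upTo (proj₁ row)))))

filterᵇ-concatMap : ∀ {A B : Set} (q : B → Bool) (f : A → List B) xs →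
  filterᵇ q (concatMap f xs) ≡ concatMap (filterᵇ q ∘ f) xs
filterᵇ-concatMap q f []       = refl
filterᵇ-concatMap q f (x ∷ xs) = trans (filter-++ (T? ∘ q) (f x) (concatMap f xs)) (cong (filterᵇ q (f x) ++_) (filterᵇ-concatMap q f xs))

filterᵇ-map-pair : ∀ {A B : Set} (q : A × B → Bool) r ys → filterᵇ q (map (r ,_) ys) ≡ map (r ,_) (filterᵇ (q ∘ (r ,_)) ys)
filterᵇ-map-pair q r []       = refl
filterᵇ-map-pair q r (y ∷ ys) with q (r , y)
... | true  = cong ((r , y) ∷_) (filterᵇ-map-pair q r ys)
... | false = filterᵇ-map-pair q r ys

lhsDen≡prodTails : ∀ α Λa Λs → lhsDen α Λa Λs ≡ prodTails (rowHookProd α (colCirc Λa Λs)) (rowsD Λa Λs)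
lhsDen≡prodTails α Λa Λs = begin
  product (map h (filterᵇ q (concatMap cells rows)))
    ≡⟨ cong (product ∘ map h) (filterᵇ-concatMap q cells rows) ⟩
  product (map h (concatMap (filterᵇ q ∘ cells) rows))
    ≡⟨ product-map-concatMap h (filterᵇ q ∘ cells) rows ⟩
  product (map (λ r → product (map h (filterᵇ q (cells r)))) rows)
    ≡⟨ cong product (range-cong 1 (length R) row≡) ⟩
  product (map (inContext atRow F R) rows)
    ≡⟨ cong product (map-range-inContext atRow atRow-isLookup₁ F R [] R [] (sym (++-identityʳ R))) ⟩
  prodCtx F [] R []
    ≡⟨ prodCtx-tails (rowHookProd α CC) [] R ⟩
  prodTails (rowHookProd α CC) R ∎
  where
  open ≡-Reasoning
  R = rowsD Λa Λs
  CC = colCirc Λa Λs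
  F = λ (_ : List (ℕ × Bool)) row below → rowHookProd α CC row below
  h = λ (s : ℕ × ℕ) → α * armD Λa Λs (proj₁ s) (proj₂ s) + legD Λa Λs (proj₁ s) (proj₂ s) + 1
  q = λ (s : ℕ × ℕ) → not (rowCirc R (proj₁ s) ∧ CC (proj₂ s))
  cells = λ r → map (r ,_) (map (1 +_) (upTo (rowLen R r)))
  rows = map (1 +_) (upTo (length R))
  legD≡ : ∀ r j → r ≤ length R → legD Λa Λs r j ≡ countᵇ (j ≤ᵇ_) (map proj₁ (drop r R))
  legD≡ r j r≤ = begin
    countᵇ ((j ≤ᵇ_) ∘ rowLen R) range           ≡⟨ sym (countᵇ-map (j ≤ᵇ_) (rowLen R) range) ⟩
    countᵇ (j ≤ᵇ_) (map (rowLen R) range)        ≡⟨ cong (countᵇ (j ≤ᵇ_)) (map-∘ range) ⟩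
    countᵇ (j ≤ᵇ_) (map proj₁ (map (atRow R) range)) ≡⟨ cong (countᵇ (j ≤ᵇ_) ∘ map proj₁) (map-lookup-drop atRow atRow-isLookup₁ R r r≤) ⟩
    countᵇ (j ≤ᵇ_) (map proj₁ (drop r R))       ∎
    where range = map (suc r +_) (upTo (length R ∸ r))
  row≡ : ∀ {i} → i < length R → product (map h (filterᵇ q (cells (suc i)))) ≡ inContext atRow F R (suc i)
  row≡ {i} i< = begin
    product (map h (filterᵇ q (map (suc i ,_) cols)))
      ≡⟨ cong (product ∘ map h) (filterᵇ-map-pair q (suc i) cols) ⟩
    product (map h (map (suc i ,_) (filterᵇ (q ∘ (suc i ,_)) cols)))
      ≡⟨ product-map-∘ h (suc i ,_) (filterᵇ (q ∘ (suc i ,_)) cols) ⟩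
    product (map (h ∘ (suc i ,_)) (filterᵇ (q ∘ (suc i ,_)) cols))
      ≡⟨ cong product (map-cong (λ j → cong (λ l → α * armD Λa Λs (suc i) j + l + 1) (legD≡ (suc i) j i<)) (filterᵇ (q ∘ (suc i ,_)) cols)) ⟩
    rowHookProd α CC (atRow R (suc i)) (drop (suc i) R) ∎
    where cols = map (1 +_) (upTo (rowLen R (suc i)))

reach< : ℕ → ℕ → ℕ → Bool
reach< j a y = (j ≤ᵇ y) ∧ (y <ᵇ a)

reach≤ : ℕ → ℕ → ℕ → Bool
reach≤ j a y = (j ≤ᵇ y) ∧ (y ≤ᵇ a)

reach<-self : ∀ j a → reach< j a a ≡ false
reach<-self j a = trans (cong ((j ≤ᵇ a) ∧_) (≥⇒<ᵇ≡false (≤-refl {a}))) (∧-zeroʳ _)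

countᵇ-reach<-≥ : ∀ j a ys → All (a ≤_) ys → countᵇ (reach< j a) ys ≡ 0
countᵇ-reach<-≥ j a ys a≤ys = countᵇ-none (reach< j a) ys (All-map (λ {y} a≤y → trans (cong ((j ≤ᵇ y) ∧_) (≥⇒<ᵇ≡false a≤y)) (∧-zeroʳ (j ≤ᵇ y))) a≤ys)

countᵇ-reach<-< : ∀ j a ys → All (_< a) ys → countᵇ (reach< j a) ys ≡ countᵇ (j ≤ᵇ_) ys
countᵇ-reach<-< j a ys ys<a = countᵇ-cong (reach< j a) (j ≤ᵇ_) ys (All-map (λ {y} y<a → trans (cong ((j ≤ᵇ y) ∧_) (<⇒<ᵇ≡true y<a)) (∧-identityʳ (j ≤ᵇ y))) ys<a)

countᵇ-reach≤-> : ∀ j a ys → All (a <_) ys → countᵇ (reach≤ j a) ys ≡ 0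
countᵇ-reach≤-> j a ys a<ys = countᵇ-none (reach≤ j a) ys (All-map (λ {y} a<y → trans (cong ((j ≤ᵇ y) ∧_) (>⇒≤ᵇ≡false a<y)) (∧-zeroʳ (j ≤ᵇ y))) a<ys)

countᵇ-reach≤-≤ : ∀ j a ys → All (_≤ a) ys → countᵇ (reach≤ j a) ys ≡ countᵇ (j ≤ᵇ_) ys
countᵇ-reach≤-≤ j a ys ys≤a = countᵇ-cong (reach≤ j a) (j ≤ᵇ_) ys (All-map (λ {y} y≤a → trans (cong ((j ≤ᵇ y) ∧_) (≤⇒≤ᵇ≡true y≤a)) (∧-identityʳ (j ≤ᵇ y))) ys≤a)

-- Below a circled row a of D[Λ] lie exactly the rows of Λa shorter than a and of Λs not longer than a.
hookCircled : ℕ → List ℕ → List ℕ → ℕ → ℕ → ℕ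
hookCircled α A S a j = α * (a ∸ j + 1) + (countᵇ (reach< j a) A + countᵇ (reach≤ j a) S) + 1

circledRowHookProd : ℕ → (ℕ → Bool) → List ℕ → List ℕ → ℕ → ℕ
circledRowHookProd α circledCol A S a = product (map (hookCircled α A S a) (filterᵇ (not ∘ circledCol) (map (1 +_) (upTo a))))

-- Below an uncircled row s lie the rows shorter than s and the t rows equal to s that follow it in Λs.
hookUncircled : ℕ → List ℕ → List ℕ → ℕ → ℕ → ℕ → ℕ
hookUncircled α A S s t j = α * (s ∸ j + 0) + (countᵇ (reach< j s) A + (countᵇ (reach< j s) S + t)) + 1

uncircledRowHookProd : ℕ → List ℕ → List ℕ → ℕ → ℕ → ℕ
uncircledRowHookProd α A S s t = prodTo (hookUncircled α A S s t) s

countᵇ-below-circled : ∀ j a BA as BS ss → All (a <_) BA → All (a <_) BS → All (_< a) as → All (_≤ a) ss →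
  countᵇ (j ≤ᵇ_) (map proj₁ (mergeRows as ss)) ≡ countᵇ (reach< j a) (BA ++ a ∷ as) + countᵇ (reach≤ j a) (BS ++ ss)
countᵇ-below-circled j a BA as BS ss a<BA a<BS as<a ss≤a = begin
  countᵇ (j ≤ᵇ_) (map proj₁ (mergeRows as ss))          ≡⟨ countᵇ-mergeRows (j ≤ᵇ_) as ss ⟩
  countᵇ (j ≤ᵇ_) as + countᵇ (j ≤ᵇ_) ss                 ≡⟨ cong₂ _+_ (sym A≡) (sym S≡) ⟩
  countᵇ (reach< j a) (BA ++ a ∷ as) + countᵇ (reach≤ j a) (BS ++ ss) ∎
  where
  open ≡-Reasoning
  A≡ : countᵇ (reach< j a) (BA ++ a ∷ as) ≡ countᵇ (j ≤ᵇ_) as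
  A≡ = begin
    countᵇ (reach< j a) (BA ++ a ∷ as)                 ≡⟨ countᵇ-++ (reach< j a) BA (a ∷ as) ⟩
    countᵇ (reach< j a) BA + countᵇ (reach< j a) (a ∷ as)
      ≡⟨ cong₂ (λ m b → m + (indicator b + countᵇ (reach< j a) as)) (countᵇ-reach<-≥ j a BA (All-map <⇒≤ a<BA)) (reach<-self j a) ⟩
    countᵇ (reach< j a) as                             ≡⟨ countᵇ-reach<-< j a as as<a ⟩
    countᵇ (j ≤ᵇ_) as                                  ∎
  S≡ : countᵇ (reach≤ j a) (BS ++ ss) ≡ countᵇ (j ≤ᵇ_) ss
  S≡ = begin
    countᵇ (reach≤ j a) (BS ++ ss)                     ≡⟨ countᵇ-++ (reach≤ j a) BS ss ⟩
    countᵇ (reach≤ j a) BS + countᵇ (reach≤ j a) ss    ≡⟨ cong (_+ countᵇ (reach≤ j a) ss) (countᵇ-reach≤-> j a BS a<BS) ⟩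
    countᵇ (reach≤ j a) ss                             ≡⟨ countᵇ-reach≤-≤ j a ss ss≤a ⟩
    countᵇ (j ≤ᵇ_) ss                                  ∎

countᵇ-below-uncircled : ∀ j s BA as BS ss → j ≤ s → All (s ≤_) BA → All (s ≤_) BS → All (_< s) as → All (_≤ s) ss →
  countᵇ (j ≤ᵇ_) (map proj₁ (mergeRows as ss)) ≡ countᵇ (reach< j s) (BA ++ as) + (countᵇ (reach< j s) (BS ++ s ∷ ss) + mult s ss)
countᵇ-below-uncircled j s BA as BS ss j≤s s≤BA s≤BS as<s ss≤s = begin
  countᵇ (j ≤ᵇ_) (map proj₁ (mergeRows as ss))          ≡⟨ countᵇ-mergeRows (j ≤ᵇ_) as ss ⟩
  countᵇ (j ≤ᵇ_) as + countᵇ (j ≤ᵇ_) ss                 ≡⟨ cong₂ _+_ (sym A≡) (sym S≡) ⟩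
  countᵇ (reach< j s) (BA ++ as) + (countᵇ (reach< j s) (BS ++ s ∷ ss) + mult s ss) ∎
  where
  open ≡-Reasoning
  A≡ : countᵇ (reach< j s) (BA ++ as) ≡ countᵇ (j ≤ᵇ_) as
  A≡ = begin
    countᵇ (reach< j s) (BA ++ as)                   ≡⟨ countᵇ-++ (reach< j s) BA as ⟩
    countᵇ (reach< j s) BA + countᵇ (reach< j s) as  ≡⟨ cong (_+ countᵇ (reach< j s) as) (countᵇ-reach<-≥ j s BA s≤BA) ⟩
    countᵇ (reach< j s) as                           ≡⟨ countᵇ-reach<-< j s as as<s ⟩
    countᵇ (j ≤ᵇ_) as                                ∎
  split : ∀ {y} → y ≤ s → indicator (j ≤ᵇ y) ≡ indicator (reach< j s y) + indicator (y ≡ᵇ s)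
  split {y} y≤s with m≤n⇒m<n∨m≡n y≤s
  ... | inj₁ y<s  rewrite <⇒<ᵇ≡true y<s | ∧-identityʳ (j ≤ᵇ y) | ≢⇒≡ᵇ≡false (<⇒≢ y<s) = sym (+-identityʳ _)
  ... | inj₂ refl rewrite reach<-self j y | ≤⇒≤ᵇ≡true j≤s | ≡ᵇ-refl y = refl
  S≡ : countᵇ (reach< j s) (BS ++ s ∷ ss) + mult s ss ≡ countᵇ (j ≤ᵇ_) ss
  S≡ = begin
    countᵇ (reach< j s) (BS ++ s ∷ ss) + mult s ss
      ≡⟨ cong (_+ mult s ss) (countᵇ-++ (reach< j s) BS (s ∷ ss)) ⟩
    countᵇ (reach< j s) BS + (indicator (reach< j s s) + countᵇ (reach< j s) ss) + mult s ss
      ≡⟨ cong₂ (λ m b → m + (indicator b + countᵇ (reach< j s) ss) + mult s ss) (countᵇ-reach<-≥ j s BS s≤BS) (reach<-self j s) ⟩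
    countᵇ (reach< j s) ss + mult s ss
      ≡⟨ sym (countᵇ-split (j ≤ᵇ_) (reach< j s) (_≡ᵇ s) ss (All-map split ss≤s)) ⟩
    countᵇ (j ≤ᵇ_) ss ∎

rowHookProd-circled : ∀ α C a BA as BS ss → All (a <_) BA → All (a <_) BS → All (_< a) as → All (_≤ a) ss →
  rowHookProd α C (a , true) (mergeRows as ss) ≡ circledRowHookProd α C (BA ++ a ∷ as) (BS ++ ss) a
rowHookProd-circled α C a BA as BS ss a<BA a<BS as<a ss≤a = cong product (map-cong
  (λ j → cong (λ n → α * (a ∸ j + 1) + n + 1) (countᵇ-below-circled j a BA as BS ss a<BA a<BS as<a ss≤a))
  (filterᵇ (not ∘ C) (map (1 +_) (upTo a))))

rowHookProd-uncircled : ∀ α C s BA as BS ss → All (s ≤_) BA → All (s ≤_) BS → All (_< s) as → All (_≤ s) ss →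
  rowHookProd α C (s , false) (mergeRows as ss) ≡ uncircledRowHookProd α (BA ++ as) (BS ++ s ∷ ss) s (mult s ss)
rowHookProd-uncircled α C s BA as BS ss s≤BA s≤BS as<s ss≤s = begin
  product (map (hook α (s , false) (mergeRows as ss)) (filterᵇ (λ _ → true) cols))
    ≡⟨ cong (product ∘ map (hook α (s , false) (mergeRows as ss))) (filter-all (T? ∘ λ _ → true) (All-universal cols)) ⟩
  product (map (hook α (s , false) (mergeRows as ss)) cols)
    ≡⟨ cong product (range-cong 1 s (λ {i} i<s →
         cong (λ n → α * (s ∸ suc i + 0) + n + 1) (countᵇ-below-uncircled (suc i) s BA as BS ss i<s s≤BA s≤BS as<s ss≤s))) ⟩
  uncircledRowHookProd α (BA ++ as) (BS ++ s ∷ ss) s (mult s ss) ∎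
  where
  open ≡-Reasoning
  cols = map (1 +_) (upTo s)
  All-universal : ∀ xs → All (λ _ → T true) xs
  All-universal = All.universal (λ _ → _)

Above : List ℕ → List ℕ → ℕ → Set
Above as ss b = All (_< b) as × All (_≤ b) ss

module _ (α : ℕ) (C : ℕ → Bool) (A S : List ℕ) where

  circledProd : List ℕ → ℕ
  circledProd = prodTails (λ a _ → circledRowHookProd α C A S a)

  uncircledProd : List ℕ → ℕ
  uncircledProd = prodOccAfter (uncircledRowHookProd α A S)

  prodTails-mergeRows : ∀ BA as BS ss → BA ++ as ≡ A → BS ++ ss ≡ S → AllPairs _>_ as → AllPairs _≥_ ss →
    All (Above as ss) BA → All (Above as ss) BS →
    prodTails (rowHookProd α C) (mergeRows as ss) ≡ circledProd as * uncircledProd ss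
  circled : ∀ BA a as BS ss → BA ++ a ∷ as ≡ A → BS ++ ss ≡ S → AllPairs _>_ (a ∷ as) → AllPairs _≥_ ss →
    All (_≤ a) ss → All (Above (a ∷ as) ss) BA → All (Above (a ∷ as) ss) BS →
    prodTails (rowHookProd α C) ((a , true) ∷ mergeRows as ss) ≡ circledProd (a ∷ as) * uncircledProd ss
  uncircled : ∀ BA as BS s ss → BA ++ as ≡ A → BS ++ s ∷ ss ≡ S → AllPairs _>_ as → AllPairs _≥_ (s ∷ ss) →
    All (_< s) as → All (Above as (s ∷ ss)) BA → All (Above as (s ∷ ss)) BS →
    prodTails (rowHookProd α C) ((s , false) ∷ mergeRows as ss) ≡ circledProd as * uncircledProd (s ∷ ss)

  prodTails-mergeRows BA []       BS []       _  _  _   _   _      _      = refl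
  prodTails-mergeRows BA (a ∷ as) BS []       eA eS as> []  aboveA aboveS = circled BA a as BS [] eA eS as> [] [] aboveA aboveS
  prodTails-mergeRows BA []       BS (s ∷ ss) eA eS []  ss≥ aboveA aboveS = uncircled BA [] BS s ss eA eS [] ss≥ [] aboveA aboveS
  prodTails-mergeRows BA (a ∷ as) BS (s ∷ ss) eA eS as>@(a>as ∷ _) ss≥@(s≥ss ∷ _) aboveA aboveS =
    if-intro {P = λ R → prodTails (rowHookProd α C) R ≡ circledProd (a ∷ as) * uncircledProd (s ∷ ss)} (s ≤ᵇ a)
      (λ s≤ᵇa → let s≤a = ≤ᵇ≡true⇒≤ s≤ᵇa in
        circled BA a as BS (s ∷ ss) eA eS as> ss≥ (s≤a ∷ All-map (λ s′≤s → ≤-trans s′≤s s≤a) s≥ss) aboveA aboveS)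
      (λ s≰ᵇa → let a<s = ≰⇒> (λ s≤a → contradiction (trans (sym (≤⇒≤ᵇ≡true s≤a)) s≰ᵇa) λ ()) in
        uncircled BA (a ∷ as) BS s ss eA eS as> ss≥ (a<s ∷ All-map (λ a′<a → <-trans a′<a a<s) a>as) aboveA aboveS)

  circled BA a as BS ss eA eS (a>as ∷ as>) ss≥ ss≤a aboveA aboveS =
    trans (cong₂ _*_ row rest) (sym (*-assoc (circledRowHookProd α C A S a) (circledProd as) (uncircledProd ss)))
    where
    row : rowHookProd α C (a , true) (mergeRows as ss) ≡ circledRowHookProd α C A S a
    row = trans (rowHookProd-circled α C a BA as BS ss (All-map (All.head ∘ proj₁) aboveA) (All-map (All.head ∘ proj₁) aboveS) a>as ss≤a)
      (cong₂ (λ A S → circledRowHookProd α C A S a) eA eS)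
    below : ∀ {b} → Above (a ∷ as) ss b → Above as ss b
    below (_ ∷ as<b , ss≤b) = as<b , ss≤b
    rest : prodTails (rowHookProd α C) (mergeRows as ss) ≡ circledProd as * uncircledProd ss
    rest = prodTails-mergeRows (BA ++ [ a ]) as BS ss (trans (∷ʳ-++ BA a as) eA) eS as> ss≥
      (++⁺ (All-map below aboveA) ((a>as , ss≤a) ∷ [])) (All-map below aboveS)

  uncircled BA as BS s ss eA eS as> (s≥ss ∷ ss≥) as<s aboveA aboveS =
    trans (cong₂ _*_ row rest) (*-x∙yz≈y∙xz (uncircledRowHookProd α A S s (mult s ss)) (circledProd as) (uncircledProd ss))
    where
    row : rowHookProd α C (s , false) (mergeRows as ss) ≡ uncircledRowHookProd α A S s (mult s ss)
    row = trans (rowHookProd-uncircled α C s BA as BS ss (All-map (All.head ∘ proj₂) aboveA) (All-map (All.head ∘ proj₂) aboveS) as<s s≥ss)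
      (cong₂ (λ A S → uncircledRowHookProd α A S s (mult s ss)) eA eS)
    below : ∀ {b} → Above as (s ∷ ss) b → Above as ss b
    below (as<b , _ ∷ ss≤b) = as<b , ss≤b
    rest : prodTails (rowHookProd α C) (mergeRows as ss) ≡ circledProd as * uncircledProd ss
    rest = prodTails-mergeRows BA as (BS ++ [ s ]) ss eA (trans (∷ʳ-++ BS s ss) eS) as> ss≥
      (All-map below aboveA) (++⁺ (All-map below aboveS) ((as<s , s≥ss) ∷ []))

≤ᵇ-suc : ∀ {j y} → j ≢ suc y → (j ≤ᵇ suc y) ≡ (j ≤ᵇ y)
≤ᵇ-suc {j} {y} j≢1+y with j ≤? y
... | yes j≤y = trans (≤⇒≤ᵇ≡true (m≤n⇒m≤1+n j≤y)) (sym (≤⇒≤ᵇ≡true j≤y))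
... | no  j≰y = trans (>⇒≤ᵇ≡false (≤∧≢⇒< (≰⇒> j≰y) (j≢1+y ∘ sym))) (sym (>⇒≤ᵇ≡false (≰⇒> j≰y)))

inLeg′≡reach< : ∀ j a y → y + 1 ≢ j → inLeg′ j a y ≡ reach< j a y
inLeg′≡reach< j a y y+1≢j rewrite +-comm y 1 = cong (_∧ (y <ᵇ a)) (≤ᵇ-suc (y+1≢j ∘ sym))

-- Outside the columns containing circles, d on an antisymmetric row of Λ̃ is the hook on the same row of D[Λ].
dCtx≡hookCircled : ∀ α A S a j → All (λ b → (b + 1 ≡ᵇ j) ≡ false) A → dCtx α A a S j ≡ hookCircled α A S a j
dCtx≡hookCircled α A S a j unmarked = begin
  α * (a ∸ j + 1) + countᵇ (inLeg′ j a) A + countᵇ (reach≤ j a) S + 1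
    ≡⟨ cong (λ n → α * (a ∸ j + 1) + n + countᵇ (reach≤ j a) S + 1)
         (countᵇ-cong (inLeg′ j a) (reach< j a) A (All-map (λ {y} → inLeg′≡reach< j a y ∘ ≡ᵇ≡false⇒≢) unmarked)) ⟩
  α * (a ∸ j + 1) + countᵇ (reach< j a) A + countᵇ (reach≤ j a) S + 1
    ≡⟨ cong (_+ 1) (+-assoc (α * (a ∸ j + 1)) _ _) ⟩
  hookCircled α A S a j ∎
  where open ≡-Reasoning

prodTo-circled : ∀ α A S (C : ℕ → Bool) → (∀ j → C j ≡ any (λ b → b + 1 ≡ᵇ j) A) →
  ∀ B a as → B ++ a ∷ as ≡ A → All (a <_) B → AllPairs _>_ (a ∷ as) →
  prodTo (dCtx α A a S) a ≡ circledRowHookProd α C A S a * product (map (λ y → dCtx α A a S (y + 1)) (reverse as))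
prodTo-circled α A S C C≡ B a as refl a<B (a>as ∷ as>) = begin
  prodTo (dCtx α A a S) a
    ≡⟨ prodTo-split-marked (dCtx α A a S) (hookCircled α A S a) C a as as> a>as C≡as unmarked-hook ⟩
  circledRowHookProd α C A S a * product (map (λ y → dCtx α A a S (y + 1)) as)
    ≡⟨ cong (circledRowHookProd α C A S a *_) (sym (product-map-reverse (λ y → dCtx α A a S (y + 1)) as)) ⟩
  circledRowHookProd α C A S a * product (map (λ y → dCtx α A a S (y + 1)) (reverse as)) ∎
  where
  open ≡-Reasoning
  C≡as : ∀ j → j ≤ a → C j ≡ any (λ b → b + 1 ≡ᵇ j) as
  C≡as j j≤a = begin
    C j                                                       ≡⟨ C≡ j ⟩
    any (λ b → b + 1 ≡ᵇ j) (B ++ a ∷ as)                      ≡⟨ any-++ (λ b → b + 1 ≡ᵇ j) B (a ∷ as) ⟩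
    any (λ b → b + 1 ≡ᵇ j) B ∨ ((a + 1 ≡ᵇ j) ∨ any (λ b → b + 1 ≡ᵇ j) as)
      ≡⟨ cong₂ (λ u v → u ∨ (v ∨ any (λ b → b + 1 ≡ᵇ j) as)) (any-none _ B (All-map (λ a<b → ≢⇒≡ᵇ≡false (>⇒≢ (longer (<⇒≤ a<b)))) a<B)) (≢⇒≡ᵇ≡false (>⇒≢ (longer ≤-refl))) ⟩
    any (λ b → b + 1 ≡ᵇ j) as                                 ∎
    where
    longer : ∀ {b} → a ≤ b → j < b + 1
    longer a≤b = <-≤-trans (s≤s j≤a) (≤-trans (s≤s a≤b) (≤-reflexive (+-comm 1 _)))
  unmarked-hook : ∀ j → 1 ≤ j → j ≤ a → C j ≡ false → dCtx α A a S j ≡ hookCircled α A S a j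
  unmarked-hook j _ _ unmarked = dCtx≡hookCircled α A S a j (any≡false⇒none _ A (trans (sym (C≡ j)) unmarked))

countᵇ-inLeg′-suc : ∀ k s L → countᵇ (inLeg′ (2 + k) s) L ≡ countᵇ (reach< (1 + k) s) L
countᵇ-inLeg′-suc k s []      = refl
countᵇ-inLeg′-suc k s (y ∷ L) rewrite +-comm y 1 = cong (indicator (reach< (1 + k) s y) +_) (countᵇ-inLeg′-suc k s L)

reach<-same : ∀ s y → reach< s s y ≡ false
reach<-same s y with s ≤? y
... | yes s≤y = trans (cong ((s ≤ᵇ y) ∧_) (≥⇒<ᵇ≡false s≤y)) (∧-zeroʳ _)
... | no  s≰y = cong (_∧ (y <ᵇ s)) (>⇒≤ᵇ≡false (≰⇒> s≰y))

dSym≡hookUncircled : ∀ α A S s t k → suc k < s → dSym α A S s t (2 + k) ≡ hookUncircled α A S s t (1 + k)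
dSym≡hookUncircled α A S s t k 1+k<s = begin
  α * (s ∸ (2 + k) + 1) + (countᵇ (inLeg′ (2 + k) s) A + countᵇ (inLeg′ (2 + k) s) S) + t + 1
    ≡⟨ cong₂ (λ m n → α * m + n + t + 1) arm (cong₂ _+_ (countᵇ-inLeg′-suc k s A) (countᵇ-inLeg′-suc k s S)) ⟩
  α * (s ∸ (1 + k) + 0) + (countᵇ (reach< (1 + k) s) A + countᵇ (reach< (1 + k) s) S) + t + 1
    ≡⟨ cong (_+ 1) (trans (+-assoc (α * (s ∸ (1 + k) + 0)) _ t) (cong (α * (s ∸ (1 + k) + 0) +_) (+-assoc (countᵇ (reach< (1 + k) s) A) _ t))) ⟩
  hookUncircled α A S s t (1 + k) ∎
  where
  open ≡-Reasoning
  arm : s ∸ (2 + k) + 1 ≡ s ∸ (1 + k) + 0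
  arm = begin
    s ∸ (2 + k) + 1     ≡⟨ +-comm (s ∸ (2 + k)) 1 ⟩
    suc (s ∸ (2 + k))   ≡⟨ sym (+-∸-assoc 1 1+k<s) ⟩
    suc s ∸ (2 + k)     ≡⟨ sym (+-identityʳ (s ∸ (1 + k))) ⟩
    s ∸ (1 + k) + 0     ∎

hookUncircled-last : ∀ α A S s t → hookUncircled α A S s t s ≡ suc t
hookUncircled-last α A S s t = begin
  α * (s ∸ s + 0) + (countᵇ (reach< s s) A + (countᵇ (reach< s s) S + t)) + 1
    ≡⟨ cong₂ (λ m n → α * (m + 0) + n + 1) (n∸n≡0 s) (cong₂ (λ u v → u + (v + t)) (none A) (none S)) ⟩
  α * 0 + t + 1  ≡⟨ cong (λ m → m + t + 1) (*-zeroʳ α) ⟩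
  t + 1          ≡⟨ +-comm t 1 ⟩
  suc t          ∎
  where
  open ≡-Reasoning
  none : ∀ L → countᵇ (reach< s s) L ≡ 0
  none L = countᵇ-none (reach< s s) L (All.universal (reach<-same s) L)

prodTo-uncircled : ∀ α A S s t →
  prodTo (dSym α A S s t) s * (if s ≡ᵇ 0 then 1 else suc t) ≡ (if s ≡ᵇ 0 then 1 else dSym α A S s t 1) * uncircledRowHookProd α A S s t
prodTo-uncircled α A S zero     t = refl
prodTo-uncircled α A S (suc s′) t = begin
  prodTo f (suc s′) * suc t
    ≡⟨ cong (λ l → product (map f l) * suc t) (range-suc 1 s′) ⟩
  f 1 * product (map f (map (2 +_) (upTo s′))) * suc t
    ≡⟨ cong (λ m → f 1 * m * suc t) shifted ⟩
  f 1 * prodTo g s′ * suc t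
    ≡⟨ *-assoc (f 1) (prodTo g s′) (suc t) ⟩
  f 1 * (prodTo g s′ * suc t)
    ≡⟨ cong (λ m → f 1 * (prodTo g s′ * m)) (sym (hookUncircled-last α A S (suc s′) t)) ⟩
  f 1 * (prodTo g s′ * g (suc s′))
    ≡⟨ cong (f 1 *_) (sym (prodTo-snoc g s′)) ⟩
  f 1 * prodTo g (suc s′) ∎
  where
  open ≡-Reasoning
  f = dSym α A S (suc s′) t
  g = hookUncircled α A S (suc s′) t
  shifted : product (map f (map (2 +_) (upTo s′))) ≡ prodTo g s′
  shifted = begin
    product (map f (map (2 +_) (upTo s′)))         ≡⟨ product-map-∘ f (2 +_) (upTo s′) ⟩
    product (map (f ∘ (2 +_)) (upTo s′))           ≡⟨ cong product (upTo-cong s′ (λ {k} k<s′ → dSym≡hookUncircled α A S (suc s′) t k (s≤s k<s′))) ⟩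
    product (map (g ∘ (1 +_)) (upTo s′))           ≡⟨ sym (product-map-∘ g (1 +_) (upTo s′)) ⟩
    prodTo g s′                                    ∎

-- An entry s ≠ 0 followed by t equal entries contributes the factor t + 1 to m_s(Λs)!.
multFactor : ℕ → ℕ → ℕ
multFactor s t = if s ≡ᵇ 0 then 1 else suc t

prodOccAfter-multFactor : ∀ M xs → All (_≤ M) xs → prodOccAfter multFactor xs ≡ prodTo (λ i → mult i xs !) M
prodOccAfter-multFactor M []       []          = sym (product-map-ones (λ i → mult i [] !) (map (1 +_) (upTo M)) (All.universal (λ _ → refl) _))
prodOccAfter-multFactor M (x ∷ xs) (x≤M ∷ xs≤M) = sym (begin
  prodTo (λ i → mult i (x ∷ xs) !) M
    ≡⟨ cong product (map-cong mult!-cons (map (1 +_) (upTo M))) ⟩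
  prodTo (λ i → (if x ≡ᵇ i then suc (mult i xs) else 1) * mult i xs !) M
    ≡⟨ product-map-* (λ i → if x ≡ᵇ i then suc (mult i xs) else 1) (λ i → mult i xs !) (map (1 +_) (upTo M)) ⟩
  prodTo (λ i → if x ≡ᵇ i then suc (mult i xs) else 1) M * prodTo (λ i → mult i xs !) M
    ≡⟨ cong₂ _*_ (prodTo-single x M (λ i → suc (mult i xs)) x≤M) (sym (prodOccAfter-multFactor M xs xs≤M)) ⟩
  multFactor x (mult x xs) * prodOccAfter multFactor xs ∎)
  where
  open ≡-Reasoning
  mult!-cons : ∀ i → mult i (x ∷ xs) ! ≡ (if x ≡ᵇ i then suc (mult i xs) else 1) * mult i xs !
  mult!-cons i with x ≡ᵇ i
  ... | true  = refl
  ... | false = sym (+-identityʳ _)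

maxL-bound : ∀ S → All (_≤ maxL S) S
maxL-bound []      = []
maxL-bound (x ∷ S) = m≤m⊔n x (maxL S) ∷ All-map (λ y≤ → ≤-trans y≤ (m≤n⊔m x (maxL S))) (maxL-bound S)

multFact≡prodOccAfter : ∀ S → multFact S ≡ prodOccAfter multFactor S
multFact≡prodOccAfter S = sym (prodOccAfter-multFactor (maxL S) S (maxL-bound S))

module _ (α : ℕ) (A S : List ℕ) (A> : AllPairs _>_ A) (S≥ : AllPairs _≥_ S) where

  lhsNum-by-rows : lhsNum α A S ≡ prodTails (λ a _ → prodTo (dCtx α A a S) a) A * prodOccAfter (λ s t → prodTo (dSym α A S s t) s) S
  lhsNum-by-rows = begin
    lhsNum α A S
      ≡⟨ lhsNum≡prodCtx α A S ⟩
    prodCtx (cellProd α) [] (reverse A ++ reverse S) []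
      ≡⟨ prodCtx-++ (cellProd α) [] (reverse A) (reverse S) [] ⟩
    prodCtx (cellProd α) [] (reverse A) (reverse S ++ []) * prodCtx (cellProd α) (reverse A) (reverse S) []
      ≡⟨ cong (λ post → prodCtx (cellProd α) [] (reverse A) post * prodCtx (cellProd α) (reverse A) (reverse S) []) (++-identityʳ (reverse S)) ⟩
    prodCtx (cellProd α) [] (reverse A) (reverse S) * prodCtx (cellProd α) (reverse A) (reverse S) []
      ≡⟨ cong₂ _*_ (prodCtx-reverse (cellProd α) [] A (reverse S)) (prodCtx-reverse (cellProd α) (reverse A) S []) ⟩
    prodCtxRev (cellProd α) [] A (reverse S) * prodCtxRev (cellProd α) (reverse A) S []
      ≡⟨ cong₂ _*_ (prodCtxRev-antisymmetric α A S (λ h x _ → prodTo h x) (λ x _ e → prodTo-cong x (λ j _ _ → e j)) [] A (reverse S) refl refl A> [])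
                   (prodCtxRev-symmetric α A S prodTo prodTo-cong [] S [] refl refl S≥ []) ⟩
    prodTails (λ a _ → prodTo (dCtx α A a S) a) A * prodOccBefore (λ s t → prodTo (dSym α A S s t) s) [] S
      ≡⟨ cong (prodTails (λ a _ → prodTo (dCtx α A a S) a) A *_) (prodOccBefore≡prodOccAfter _ [] S) ⟩
    prodTails (λ a _ → prodTo (dCtx α A a S) a) A * prodOccAfter (λ s t → prodTo (dSym α A S s t) s) S ∎
    where open ≡-Reasoning

  rhsCircles-by-rows :
    product (concatMap (λ i → map (λ j → dC α (tilde A S) i (at (tilde A S) j + 1)) (interval 1 (i ∸ 1))) (interval 1 (length A)))
    ≡ prodTails (λ a as → product (map (λ y → dCtx α A a S (y + 1)) (reverse as))) A
  rhsCircles-by-rows = trans (rhsCircles≡prodCtx α A S) (trans (prodCtx-reverse (circleColProd α) [] A (reverse S))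
    (prodCtxRev-antisymmetric α A S (λ h _ pre → product (map (λ y → h (y + 1)) pre)) (λ _ pre e → cong product (map-cong (λ y → e (y + 1)) pre))
      [] A (reverse S) refl refl A> []))

  rhsFirst-by-rows :
    product (map (λ i → dC α (tilde A S) i 1) (interval (suc ((length A + length S) ∸ ellS S)) (length A + length S)))
    ≡ prodOccAfter (λ s t → if s ≡ᵇ 0 then 1 else dSym α A S s t 1) S
  rhsFirst-by-rows = trans (rhsFirst≡prodCtx α A S S≥) (trans (prodCtx-reverse (firstCell α) (reverse A) S [])
    (trans (prodCtxRev-symmetric α A S (λ h x → if x ≡ᵇ 0 then 1 else h 1) first-cong [] S [] refl refl S≥ [])
      (prodOccBefore≡prodOccAfter _ [] S)))
    where
    first-cong : ∀ {h h′ : ℕ → ℕ} x → (∀ j → 1 ≤ j → j ≤ x → h j ≡ h′ j) → (if x ≡ᵇ 0 then 1 else h 1) ≡ (if x ≡ᵇ 0 then 1 else h′ 1)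
    first-cong zero    e = refl
    first-cong (suc x) e = e 1 (s≤s z≤n) (s≤s z≤n)

  lhsDen-by-rows : lhsDen α A S ≡ prodTails (λ a _ → circledRowHookProd α (colCirc A S) A S a) A * prodOccAfter (uncircledRowHookProd α A S) S
  lhsDen-by-rows = trans (lhsDen≡prodTails α A S) (trans (cong (prodTails (rowHookProd α (colCirc A S))) (rowsD≡mergeRows A S A> S≥))
    (prodTails-mergeRows α (colCirc A S) A S [] A [] S refl refl A> S≥ [] []))

  antisymmetric-rows : prodTails (λ a _ → prodTo (dCtx α A a S) a) A
    ≡ prodTails (λ a _ → circledRowHookProd α (colCirc A S) A S a) A * prodTails (λ a as → product (map (λ y → dCtx α A a S (y + 1)) (reverse as))) A
  antisymmetric-rows = trans (prodTails-cong A row) (prodTails-* _ _ A)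
    where
    row : ∀ B a as → B ++ a ∷ as ≡ A → prodTo (dCtx α A a S) a
      ≡ circledRowHookProd α (colCirc A S) A S a * product (map (λ y → dCtx α A a S (y + 1)) (reverse as))
    row B a as e with AllPairs-++⁻ B (a ∷ as) (subst (AllPairs _>_) (sym e) A>)
    ... | B>aas , aas> = prodTo-circled α A S (colCirc A S) (λ j → colCirc≡ A S j A> S≥) B a as e (All-map All.head B>aas) aas>

  symmetric-rows : prodOccAfter (λ s t → prodTo (dSym α A S s t) s) S * prodOccAfter multFactor S
    ≡ prodOccAfter (λ s t → if s ≡ᵇ 0 then 1 else dSym α A S s t 1) S * prodOccAfter (uncircledRowHookProd α A S) S
  symmetric-rows = trans (sym (prodOccAfter-* _ _ S)) (trans (prodOccAfter-cong S (prodTo-uncircled α A S)) (prodOccAfter-* _ _ S))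

lemma3 : (Λa Λs : List ℕ) → IsSuperpartition Λa Λs → (α : ℕ) →
    lhsNum α Λa Λs * multFact Λs ≡ rhs α Λa Λs * lhsDen α Λa Λs
lemma3 A S sp α = begin
  lhsNum α A S * multFact S                   ≡⟨ cong₂ _*_ (lhsNum-by-rows α A S A> S≥) (multFact≡prodOccAfter S) ⟩
  numA * numS * prodOccAfter multFactor S     ≡⟨ *-assoc numA numS _ ⟩
  numA * (numS * prodOccAfter multFactor S)   ≡⟨ cong₂ _*_ (antisymmetric-rows α A S A> S≥) (symmetric-rows α A S A> S≥) ⟩
  hookA * circles * (first * hookS)           ≡⟨ cong (_* (first * hookS)) (*-comm hookA circles) ⟩
  circles * hookA * (first * hookS)           ≡⟨ *-interchange circles hookA first hookS ⟩
  circles * first * (hookA * hookS)           ≡⟨ cong (_* (hookA * hookS)) (*-comm circles first) ⟩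
  first * circles * (hookA * hookS)           ≡⟨ sym (cong₂ _*_ (cong₂ _*_ (rhsFirst-by-rows α A S A> S≥) (rhsCircles-by-rows α A S A> S≥)) (lhsDen-by-rows α A S A> S≥)) ⟩
  rhs α A S * lhsDen α A S                    ∎
  where
  open ≡-Reasoning
  A> = Linked⇒AllPairs (λ a>b b>c → <-trans b>c a>b) (IsSuperpartition.antisym-strict sp)
  S≥ = Linked⇒AllPairs (λ a≥b b≥c → ≤-trans b≥c a≥b) (IsSuperpartition.sym-weak sp)
  numA = prodTails (λ a _ → prodTo (dCtx α A a S) a) A
  numS = prodOccAfter (λ s t → prodTo (dSym α A S s t) s) S
  hookA = prodTails (λ a _ → circledRowHookProd α (colCirc A S) A S a) A
  hookS = prodOccAfter (uncircledRowHookProd α A S) S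
  circles = prodTails (λ a as → product (map (λ y → dCtx α A a S (y + 1)) (reverse as))) A
  first = prodOccAfter (λ s t → if s ≡ᵇ 0 then 1 else dSym α A S s t 1) S
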